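{- Let $k\ge 2$ and positive integers $a_1,\dots,a_k$ be fixed. Then for every sufficiently large integer $p$, the complete multipartite graph $K_{pa_1,\dots,pa_k}$ has an embedded $K_{a_1,\dots,a_k}$-decomposition.
   Context: $K_{a_1,\dots,a_k}$ denotes the complete $k$-partite graph with partite classes of sizes $a_1,\dots,a_k$. An $F$-decomposition of a graph $G$ is a collection of pairwise edge-disjoint subgraphs of $G$, each isomorphic to $F$, whose edge sets together cover $E(G)$. Let $G$ and $F$ be $k$-partite graphs with vertex partitions $V=V_1\cup\dots\cup V_k$ and $X=X_1\cup\dots\cup X_k$, where $|V|/|X|=p$ is an integer and $|V_i|=p|X_i|$ for all $i$. An embedded $F$-decomposition of $G$ is an $F$-decomposition of $G$ such that each $V_i$ is partitioned into $p$ sets $V_i=V_{i,1}\cup\dots\cup V_{i,p}$ and, for each copy of $F$ in the decomposition, each partite set $X_i$ (the image of the $i$-th class of $F$) coincides with some $V_{i,j}$ inside $V_i$. Here $K_{pa_1,\dots,pa_k}$ and $K_{a_1,\dots,a_k}$ are considered with their natural $k$-partitions into classes of sizes $pa_i$ and $a_i$. -}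

module Defs where

open import Data.Nat using (ℕ; _*_)
open import Data.Fin using (Fin)
open import Data.List using (List; length; lookup)
open import Data.Product using (Σ; ∃; ∃-syntax; _×_)
open import Relation.Binary.PropositionalEquality using (_≡_; _≢_)
open import Function.Definitions using (Injective)

-- The host graph G = K_{p a_1, ..., p a_k}: vertex set is the disjoint union of
-- the classes V_i = Fin (p * a i), i : Fin k; two vertices are adjacent iff
-- they lie in different classes.
Vertex : (k : ℕ) → (Fin k → ℕ) → ℕ → Set
Vertex k a p = Σ (Fin k) λ i → Fin (p * a i)

-- A copy of F = K_{a_1,...,a_k} in G respecting the k-partition: an injective
-- map of the i-th class X_i = Fin (a i) of F into V_i, for every i.
record Copy (k : ℕ) (a : Fin k → ℕ) (p : ℕ) : Set where
  field
    emb : (i : Fin k) → Fin (a i) → Fin (p * a i)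
    emb-inj : (i : Fin k) → Injective _≡_ _≡_ (emb i)
open Copy public

-- The (ordered) pair of vertices (i , u), (j , v) is an edge of the copy c:
-- i ≠ j and u, v are images of vertices of X_i, X_j (F is complete k-partite,
-- so all such pairs are edges of F).
EdgeOf : ∀ {k a p} → Copy k a p → (i : Fin k) → Fin (p * a i) → (j : Fin k) → Fin (p * a j) → Set
EdgeOf c i u j v = i ≢ j × (∃[ x ] emb c i x ≡ u) × (∃[ y ] emb c j y ≡ v)

record EmbeddedDecomposition (k : ℕ) (a : Fin k → ℕ) (p : ℕ) : Set where
  field
    part : (i : Fin k) → Fin (p * a i) → Fin p
    part-nonempty : (i : Fin k) (j : Fin p) → ∃[ u ] part i u ≡ j
    copies : List (Copy k a p)
    -- each image of X_i coincides with some V_{i,j}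
    embedded : (n : Fin (length copies)) (i : Fin k) →
               ∃[ j ] ((u : Fin (p * a i)) →
                 (part i u ≡ j → ∃[ x ] emb (lookup copies n) i x ≡ u)
                 × ((∃[ x ] emb (lookup copies n) i x ≡ u) → part i u ≡ j))
    cover : (i j : Fin k) (u : Fin (p * a i)) (v : Fin (p * a j)) → i ≢ j →
            ∃[ n ] EdgeOf (lookup copies n) i u j v
    disjoint : (i j : Fin k) (u : Fin (p * a i)) (v : Fin (p * a j)) →
               (n m : Fin (length copies)) →
               EdgeOf (lookup copies n) i u j v → EdgeOf (lookup copies m) i u j v → n ≡ m

module Submission where

-- An embedded K_{a_1..a_k}-decomposition of K_{pa_1..pa_k} is the same as an
-- orthogonal array OA(k, p) (k columns, strength 2, index 1) on the symbols
-- Fin p: cut each class V_i into p blocks of size a_i, and let each row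
-- (x_1, ..., x_k) give the copy of K_{a_1..a_k} on the blocks x_1, ..., x_k;
-- then every pair of blocks in distinct classes is used by exactly one copy.

open import Defs
open import Data.Nat using (ℕ; _≤_; suc; z≤n; s≤s)
open import Data.Fin using (Fin)
open import Data.Product using (∃-syntax; _,_)

module Congruence where

  open import Data.Nat as ℕ using (ℕ; zero; suc; NonZero)
  import Data.Nat.Properties as ℕP
  open import Data.Integer using (ℤ; +_; -[1+_]; _+_; _-_; _*_; -_)
  import Data.Integer.Properties as ℤP
  open import Data.Integer.DivMod using (_%ℕ_; _/ℕ_; n%ℕd<d; a≡a%ℕn+[a/ℕn]*n)
  open import Data.Integer.Tactic.RingSolver using (solve-∀)
  open import Data.Fin using (Fin; toℕ; fromℕ<)
  import Data.Fin.Properties as FinP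
  open import Data.Empty using (⊥-elim)
  open import Relation.Binary.Bundles using (Setoid)
  open import Relation.Binary.PropositionalEquality
  import Relation.Binary.Reasoning.Setoid as SetoidReasoning

  infix 4 _≈[_]_
  record _≈[_]_ (a : ℤ) (n : ℕ) (b : ℤ) : Set where
    constructor mk
    field
      quo : ℤ
      eqn : a - b ≡ quo * + n

  module _ {n : ℕ} where

    ≈-refl : ∀ {a} → a ≈[ n ] a
    ≈-refl {a} = mk (+ 0) (trans (ℤP.+-inverseʳ a) (sym (ℤP.*-zeroˡ (+ n))))

    ≈-reflexive : ∀ {a b} → a ≡ b → a ≈[ n ] b
    ≈-reflexive refl = ≈-refl

    ≈-sym : ∀ {a b} → a ≈[ n ] b → b ≈[ n ] a
    ≈-sym {a} {b} (mk q e) = mk (- q) (begin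
        b - a         ≡⟨ swap a b ⟩
        - (a - b)     ≡⟨ cong -_ e ⟩
        - (q * + n)   ≡⟨ ℤP.neg-distribˡ-* q (+ n) ⟩
        - q * + n     ∎)
      where open ≡-Reasoning
            swap : ∀ a b → b - a ≡ - (a - b)
            swap = solve-∀

    ≈-trans : ∀ {a b c} → a ≈[ n ] b → b ≈[ n ] c → a ≈[ n ] c
    ≈-trans {a} {b} {c} (mk q e) (mk r f) = mk (q + r) (begin
        a - c                ≡⟨ split a b c ⟩
        (a - b) + (b - c)    ≡⟨ cong₂ _+_ e f ⟩
        q * + n + r * + n    ≡⟨ ℤP.*-distribʳ-+ (+ n) q r ⟨
        (q + r) * + n        ∎)
      where open ≡-Reasoning
            split : ∀ a b c → a - c ≡ (a - b) + (b - c)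
            split = solve-∀

    ≈-+ : ∀ {a a' b b'} → a ≈[ n ] a' → b ≈[ n ] b' → a + b ≈[ n ] a' + b'
    ≈-+ {a} {a'} {b} {b'} (mk q e) (mk r f) = mk (q + r) (begin
        a + b - (a' + b')        ≡⟨ regroup a a' b b' ⟩
        (a - a') + (b - b')      ≡⟨ cong₂ _+_ e f ⟩
        q * + n + r * + n        ≡⟨ ℤP.*-distribʳ-+ (+ n) q r ⟨
        (q + r) * + n            ∎)
      where open ≡-Reasoning
            regroup : ∀ a a' b b' → a + b - (a' + b') ≡ (a - a') + (b - b')
            regroup = solve-∀

    ≈-*ˡ : ∀ c {a a'} → a ≈[ n ] a' → c * a ≈[ n ] c * a'
    ≈-*ˡ c {a} {a'} (mk q e) = mk (c * q) (begin
        c * a - c * a'   ≡⟨ factor c a a' ⟩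
        c * (a - a')     ≡⟨ cong (c *_) e ⟩
        c * (q * + n)    ≡⟨ ℤP.*-assoc c q (+ n) ⟨
        c * q * + n      ∎)
      where open ≡-Reasoning
            factor : ∀ c a a' → c * a - c * a' ≡ c * (a - a')
            factor = solve-∀

    ≈-neg : ∀ {a a'} → a ≈[ n ] a' → - a ≈[ n ] - a'
    ≈-neg {a} {a'} p =
      subst₂ (_≈[ n ]_) (ℤP.-1*i≡-i a) (ℤP.-1*i≡-i a') (≈-*ˡ (- + 1) p)

    ≈-- : ∀ {a a' b b'} → a ≈[ n ] a' → b ≈[ n ] b' → a - b ≈[ n ] a' - b'
    ≈-- p q = ≈-+ p (≈-neg q)

    ≈-*ʳ : ∀ c {a a'} → a ≈[ n ] a' → a * c ≈[ n ] a' * c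
    ≈-*ʳ c {a} {a'} p =
      subst₂ (_≈[ n ]_) (ℤP.*-comm c a) (ℤP.*-comm c a') (≈-*ˡ c p)

    ≈-* : ∀ {a a' b b'} → a ≈[ n ] a' → b ≈[ n ] b' → a * b ≈[ n ] a' * b'
    ≈-* {a' = a'} {b = b} p q = ≈-trans (≈-*ʳ b p) (≈-*ˡ a' q)

    ≈-multiple : ∀ q → q * + n ≈[ n ] + 0
    ≈-multiple q = mk q (ℤP.+-identityʳ (q * + n))

  ≈-setoid : ℕ → Setoid _ _
  ≈-setoid n = record
    { Carrier = ℤ ; _≈_ = _≈[ n ]_
    ; isEquivalence = record { refl = ≈-refl ; sym = ≈-sym ; trans = ≈-trans } }

  module ≈-Reasoning (n : ℕ) = SetoidReasoning (≈-setoid n)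

  module Reduction (n : ℕ) .{{_ : NonZero n}} where

    red : ℤ → Fin n
    red a = fromℕ< (n%ℕd<d a n)

    toℤ : Fin n → ℤ
    toℤ x = + toℕ x

    red-≈ : ∀ a → toℤ (red a) ≈[ n ] a
    red-≈ a rewrite FinP.toℕ-fromℕ< (n%ℕd<d a n) =
      ≈-sym (mk (a /ℕ n) (begin
        a - + (a %ℕ n)                              ≡⟨ cong (_- + (a %ℕ n)) (a≡a%ℕn+[a/ℕn]*n a n) ⟩
        + (a %ℕ n) + (a /ℕ n) * + n - + (a %ℕ n)    ≡⟨ cancel (+ (a %ℕ n)) ((a /ℕ n) * + n) ⟩
        (a /ℕ n) * + n                              ∎))
      where open ≡-Reasoning
            cancel : ∀ x y → x + y - x ≡ y
            cancel = solve-∀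

    noPositiveQuotient : ∀ r r' m → r ℕ.< n → + r - + r' ≢ + suc m * + n
    noPositiveQuotient r r' m r<n e = ℕP.<⇒≱ r<n n≤r
      where
        open ≡-Reasoning
        move : ∀ x y z → x - y ≡ z → x ≡ y + z
        move x y z e = trans (split x y) (cong (λ w → y + w) e)
          where split : ∀ x y → x ≡ y + (x - y)
                split = solve-∀
        r≡ : r ≡ r' ℕ.+ suc m ℕ.* n
        r≡ = ℤP.+-injective (begin
          + r                         ≡⟨ move (+ r) (+ r') _ e ⟩
          + r' + + suc m * + n        ≡⟨ cong (λ w → + r' + w) (ℤP.pos-* (suc m) n) ⟨
          + r' + + (suc m ℕ.* n)      ≡⟨ ℤP.pos-+ r' (suc m ℕ.* n) ⟨
          + (r' ℕ.+ suc m ℕ.* n)      ∎)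
        n≤r : n ℕ.≤ r
        n≤r = ℕP.≤-trans (ℕP.m≤m+n n (m ℕ.* n))
                (ℕP.≤-trans (ℕP.m≤n+m (suc m ℕ.* n) r') (ℕP.≤-reflexive (sym r≡)))

    canonical : ∀ r r' → r ℕ.< n → r' ℕ.< n → + r ≈[ n ] + r' → r ≡ r'
    canonical r r' r<n r'<n (mk (+ zero) e) =
      ℤP.+-injective (ℤP.i-j≡0⇒i≡j (+ r) (+ r') e)
    canonical r r' r<n r'<n (mk (+ suc m) e) = ⊥-elim (noPositiveQuotient r r' m r<n e)
    canonical r r' r<n r'<n p@(mk -[1+ m ] _) =
      ⊥-elim (noPositiveQuotient r' r m r'<n (_≈[_]_.eqn (≈-sym p)))

    canonicalFin : ∀ (x y : Fin n) → toℤ x ≈[ n ] toℤ y → x ≡ y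
    canonicalFin x y p =
      FinP.toℕ-injective (canonical (toℕ x) (toℕ y) (FinP.toℕ<n x) (FinP.toℕ<n y) p)

    red-cong : ∀ {a b} → a ≈[ n ] b → red a ≡ red b
    red-cong {a} {b} p = canonicalFin (red a) (red b)
      (≈-trans (red-≈ a) (≈-trans p (≈-sym (red-≈ b))))

    red-toℤ : ∀ x → red (toℤ x) ≡ x
    red-toℤ x = canonicalFin _ _ (red-≈ (toℤ x))

    red-≈-toℤ : ∀ {a} {x : Fin n} → a ≈[ n ] toℤ x → red a ≡ x
    red-≈-toℤ {a} {x} p = trans (red-cong p) (red-toℤ x)

    red-injective : ∀ {a b} → red a ≡ red b → a ≈[ n ] b
    red-injective {a} {b} e =
      ≈-trans (≈-sym (red-≈ a)) (subst (λ z → toℤ z ≈[ n ] b) (sym e) (red-≈ b))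


module OrthogonalArrays where

  open import Data.Nat using (ℕ; suc; _*_)
  open import Data.Fin as Fin using (Fin; zero)
  import Data.Fin.Properties as FinP
  open import Data.Product using (_×_; _,_)
  open import Function.Bundles using (_↔_; Inverse)
  open import Function.Properties.Inverse using (↔-refl; ↔-sym)
  open import Data.Product.Function.NonDependent.Propositional using (_×-↔_)
  open import Relation.Binary.PropositionalEquality

  record OrthogonalArray (k : ℕ) (S R : Set) : Set where
    field
      entry  : R → Fin k → S
      row    : (i j : Fin k) → i ≢ j → S → S → R
      row-i  : ∀ i j i≢j x y → entry (row i j i≢j x y) i ≡ x
      row-j  : ∀ i j i≢j x y → entry (row i j i≢j x y) j ≡ y
      unique : ∀ i j → i ≢ j → ∀ r r' →
               entry r i ≡ entry r' i → entry r j ≡ entry r' j → r ≡ r'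

  OA : ℕ → Set → Set
  OA k S = OrthogonalArray k S (S × S)

  transport : ∀ {k S S' R R'} → S ↔ S' → R ↔ R' →
              OrthogonalArray k S R → OrthogonalArray k S' R'
  transport {k} {S} {S'} {R} {R'} σ ρ O = record
    { entry  = λ r i → σ.to (entry (ρ.from r) i)
    ; row    = λ i j i≢j x y → ρ.to (row i j i≢j (σ.from x) (σ.from y))
    ; row-i  = λ i j i≢j x y → entry-row i i≢j x y (row-i i j i≢j _ _)
    ; row-j  = λ i j i≢j x y → entry-row j i≢j x y (row-j i j i≢j _ _)
    ; unique = λ i j i≢j r r' eᵢ eⱼ →
        from-injective ρ (unique i j i≢j _ _ (to-injective σ eᵢ) (to-injective σ eⱼ))
    }
    where
      open OrthogonalArray O
      module σ = Inverse σ
      module ρ = Inverse ρ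
      to-injective : ∀ {A B} (e : A ↔ B) {x y} → Inverse.to e x ≡ Inverse.to e y → x ≡ y
      to-injective e {x} {y} p =
        trans (sym (Inverse.strictlyInverseʳ e x))
              (trans (cong (Inverse.from e) p) (Inverse.strictlyInverseʳ e y))
      from-injective : ∀ {A B} (e : A ↔ B) {x y} → Inverse.from e x ≡ Inverse.from e y → x ≡ y
      from-injective e = to-injective (↔-sym e)
      entry-row : ∀ {i j} c (i≢j : i ≢ j) x y {z} →
                  entry (row i j i≢j (σ.from x) (σ.from y)) c ≡ σ.from z →
                  σ.to (entry (ρ.from (ρ.to (row i j i≢j (σ.from x) (σ.from y)))) c) ≡ z
      entry-row c i≢j x y {z} e =
        trans (cong (λ r → σ.to (entry r c)) (ρ.strictlyInverseʳ _))
              (trans (cong σ.to e) (σ.strictlyInverseˡ z))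

  relabel : ∀ {k S S'} → S ↔ S' → OA k S → OA k S'
  relabel σ = transport σ (σ ×-↔ σ)

  relabel-idempotent : ∀ {k S S'} (σ : S ↔ S') (O : OA k S) {z} →
                       (∀ i → OrthogonalArray.entry O (z , z) i ≡ z) →
                       ∀ i → OrthogonalArray.entry (relabel σ O) (Inverse.to σ z , Inverse.to σ z) i ≡ Inverse.to σ z
  relabel-idempotent σ O {z} idem i =
    cong (Inverse.to σ) (trans (cong (λ x → OrthogonalArray.entry O (x , x) i) (Inverse.strictlyInverseʳ σ z)) (idem i))

  rowsAsPairs : ∀ {k S R} → OrthogonalArray (suc (suc k)) S R → R ↔ (S × S)
  rowsAsPairs {k} {S} {R} O = record
    { to = λ r → entry r zero , entry r one
    ; from = λ (x , y) → row zero one 0≢1 x y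
    ; to-cong = cong _
    ; from-cong = cong _
    ; inverse = (λ { refl → cong₂ _,_ (row-i zero one 0≢1 _ _) (row-j zero one 0≢1 _ _) })
              , (λ { refl → unique zero one 0≢1 _ _ (row-i zero one 0≢1 _ _) (row-j zero one 0≢1 _ _) })
    }
    where
      open OrthogonalArray O
      one : Fin (suc (suc k))
      one = Fin.suc zero
      0≢1 : zero ≢ one
      0≢1 ()

  toOA : ∀ {k S R} → OrthogonalArray (suc (suc k)) S R → OA (suc (suc k)) S
  toOA O = transport ↔-refl (rowsAsPairs O) O

  enumerateRows : ∀ {k p} → OA k (Fin p) → OrthogonalArray k (Fin p) (Fin (p * p))
  enumerateRows = transport ↔-refl (↔-sym FinP.*↔×)


module Decomposition where

  open OrthogonalArrays
  open import Data.Nat using (ℕ; _*_; _≤_)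
  open import Data.Fin using (Fin; combine; remQuot; cast; fromℕ<)
  import Data.Fin.Properties as FinP
  open import Data.List using (List; length; lookup; tabulate)
  open import Data.List.Properties using (length-tabulate; lookup-tabulate)
  open import Data.Product using (_,_; proj₁; proj₂; ∃-syntax)
  open import Relation.Binary.PropositionalEquality

  module FromOrthogonalArray (k : ℕ) (a : Fin k → ℕ) (a-pos : ∀ i → 1 ≤ a i)
                             (p N : ℕ) (O : OrthogonalArray k (Fin p) (Fin N)) where
    open OrthogonalArray O

    block : (i : Fin k) → Fin (p * a i) → Fin p
    block i u = proj₁ (remQuot {p} (a i) u)

    offset : (i : Fin k) → Fin (p * a i) → Fin (a i)
    offset i u = proj₂ (remQuot {p} (a i) u)

    copyOf : Fin N → Copy k a p
    copyOf r = record
      { emb = λ i x → combine (entry r i) x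
      ; emb-inj = λ i {x} {y} → FinP.combine-injectiveʳ (entry r i) x (entry r i) y }

    image⇒block : ∀ r i u → (∃[ x ] emb (copyOf r) i x ≡ u) → block i u ≡ entry r i
    image⇒block r i u (x , refl) = cong proj₁ (FinP.remQuot-combine (entry r i) x)

    block⇒image : ∀ r i u → block i u ≡ entry r i → ∃[ x ] emb (copyOf r) i x ≡ u
    block⇒image r i u e =
      offset i u , trans (cong (λ b → combine b (offset i u)) (sym e)) (FinP.combine-remQuot {p} (a i) u)

    copies : List (Copy k a p)
    copies = tabulate copyOf

    rowOf : Fin (length copies) → Fin N
    rowOf = cast (length-tabulate copyOf)

    indexOf : Fin N → Fin (length copies)
    indexOf = cast (sym (length-tabulate copyOf))

    rowOf-indexOf : ∀ r → rowOf (indexOf r) ≡ r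
    rowOf-indexOf = FinP.cast-involutive (length-tabulate copyOf) (sym (length-tabulate copyOf))

    indexOf-rowOf : ∀ n → indexOf (rowOf n) ≡ n
    indexOf-rowOf = FinP.cast-involutive (sym (length-tabulate copyOf)) (length-tabulate copyOf)

    lookup-copies : ∀ n → lookup copies n ≡ copyOf (rowOf n)
    lookup-copies n = trans (cong (lookup copies) (sym (indexOf-rowOf n)))
                            (lookup-tabulate copyOf (rowOf n))

    image⇒blockₙ : ∀ n i u → (∃[ x ] emb (lookup copies n) i x ≡ u) → block i u ≡ entry (rowOf n) i
    image⇒blockₙ n i u img =
      image⇒block (rowOf n) i u (subst (λ c → ∃[ x ] emb c i x ≡ u) (lookup-copies n) img)

    block⇒imageₙ : ∀ n i u → block i u ≡ entry (rowOf n) i → ∃[ x ] emb (lookup copies n) i x ≡ u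
    block⇒imageₙ n i u e =
      subst (λ c → ∃[ x ] emb c i x ≡ u) (sym (lookup-copies n)) (block⇒image (rowOf n) i u e)

    -- Every edge uv between V_i and V_j lies in the copy of the unique row
    -- having the blocks of u and v in columns i and j.
    cover : (i j : Fin k) (u : Fin (p * a i)) (v : Fin (p * a j)) → i ≢ j →
            ∃[ n ] EdgeOf (lookup copies n) i u j v
    cover i j u v i≢j = n , i≢j , block⇒imageₙ n i u (sym eᵢ) , block⇒imageₙ n j v (sym eⱼ)
      where
        r : Fin N
        r = row i j i≢j (block i u) (block j v)
        n : Fin (length copies)
        n = indexOf r
        eᵢ : entry (rowOf n) i ≡ block i u
        eᵢ = trans (cong (λ r → entry r i) (rowOf-indexOf r)) (row-i i j i≢j _ _)
        eⱼ : entry (rowOf n) j ≡ block j v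
        eⱼ = trans (cong (λ r → entry r j) (rowOf-indexOf r)) (row-j i j i≢j _ _)

    -- Two copies containing the edge uv come from rows that agree in columns
    -- i and j (both have the blocks of u and v there), hence coincide.
    disjoint : (i j : Fin k) (u : Fin (p * a i)) (v : Fin (p * a j)) → (n m : Fin (length copies)) →
               EdgeOf (lookup copies n) i u j v → EdgeOf (lookup copies m) i u j v → n ≡ m
    disjoint i j u v n m (i≢j , uₙ , vₙ) (_ , uₘ , vₘ) =
      trans (sym (indexOf-rowOf n)) (trans (cong indexOf same-row) (indexOf-rowOf m))
      where
        same-row : rowOf n ≡ rowOf m
        same-row = unique i j i≢j (rowOf n) (rowOf m)
          (trans (sym (image⇒blockₙ n i u uₙ)) (image⇒blockₙ m i u uₘ))
          (trans (sym (image⇒blockₙ n j v vₙ)) (image⇒blockₙ m j v vₘ))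

    decomposition : EmbeddedDecomposition k a p
    decomposition = record
      { part          = block
      ; part-nonempty = λ i b → combine b (fromℕ< (a-pos i)) ,
                                cong proj₁ (FinP.remQuot-combine b (fromℕ< (a-pos i)))
      ; copies        = copies
      ; embedded      = λ n i → entry (rowOf n) i , λ u → block⇒imageₙ n i u , image⇒blockₙ n i u
      ; cover         = cover
      ; disjoint      = disjoint
      }


module Linear where

  open Congruence
  open OrthogonalArrays
  open import Data.Nat using (ℕ; suc; NonZero; _≤_; _<_; _∸_)
  open import Data.Nat.Divisibility using (_∣_)
  import Data.Nat.Properties as ℕP
  open import Data.Integer using (ℤ; +_; _+_; _-_; _*_; -_)
  import Data.Integer.Properties as ℤP
  open import Data.Integer.Tactic.RingSolver using (solve-∀)
  open import Data.Fin using (Fin; toℕ)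
  import Data.Fin.Properties as FinP
  open import Data.Product using (Σ; _×_; _,_; proj₁; proj₂)
  open import Data.Empty using (⊥-elim)
  open import Relation.Binary.PropositionalEquality
  open import Relation.Binary.Definitions using (tri<; tri≈; tri>)

  Unit : ℕ → ℤ → Set
  Unit n d = Σ ℤ λ e → d * e ≈[ n ] + 1

  col : ∀ {c} → Fin c → ℤ
  col i = + toℕ i

  -- Two columns i ≠ j determine the row as soon as i - j is
  -- invertible modulo n, by solving a 2×2 linear system.
  module LinearArray (c n : ℕ) .{{_ : NonZero n}}
                     (inverse : (i j : Fin c) → i ≢ j → Unit n (col i - col j)) where
    open Reduction n
    open ≈-Reasoning n

    entry : Fin n × Fin n → Fin c → Fin n
    entry (a , b) i = red (toℤ a + col i * toℤ b)

    cancel : ∀ i j (i≢j : i ≢ j) z → proj₁ (inverse i j i≢j) * ((col i - col j) * z) ≈[ n ] z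
    cancel i j i≢j z = begin
        e * (d * z)   ≡⟨ reassoc e d z ⟩
        (d * e) * z   ≈⟨ ≈-*ʳ z (proj₂ (inverse i j i≢j)) ⟩
        + 1 * z       ≡⟨ ℤP.*-identityˡ z ⟩
        z             ∎
      where e = proj₁ (inverse i j i≢j)
            d = col i - col j
            reassoc : ∀ e d z → e * (d * z) ≡ (d * e) * z
            reassoc = solve-∀

    row : (i j : Fin c) → i ≢ j → Fin n → Fin n → Fin n × Fin n
    row i j i≢j x y = red (toℤ x - col i * toℤ b) , b
      where b = red (proj₁ (inverse i j i≢j) * (toℤ x - toℤ y))

    row-i : ∀ i j i≢j x y → entry (row i j i≢j x y) i ≡ x
    row-i i j i≢j x y = red-≈-toℤ (begin
        toℤ (red (toℤ x - col i * b)) + col i * b   ≈⟨ ≈-+ (red-≈ (toℤ x - col i * b)) (≈-refl {a = col i * b}) ⟩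
        toℤ x - col i * b + col i * b               ≡⟨ cancelRight (toℤ x) (col i * b) ⟩
        toℤ x                                       ∎)
      where b = toℤ (proj₂ (row i j i≢j x y))
            cancelRight : ∀ x w → x - w + w ≡ x
            cancelRight = solve-∀

    row-j : ∀ i j i≢j x y → entry (row i j i≢j x y) j ≡ y
    row-j i j i≢j x y = red-≈-toℤ (begin
        toℤ (red (toℤ x - col i * b)) + col j * b   ≈⟨ ≈-+ (red-≈ (toℤ x - col i * b)) (≈-refl {a = col j * b}) ⟩
        toℤ x - col i * b + col j * b               ≡⟨ regroup (toℤ x) (col i) (col j) b ⟩
        toℤ x - (col i - col j) * b
          ≈⟨ ≈-- (≈-refl {a = toℤ x}) (≈-*ˡ (col i - col j) (red-≈ (e * (toℤ x - toℤ y)))) ⟩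
        toℤ x - (col i - col j) * (e * (toℤ x - toℤ y))  ≡⟨ cong (λ w → toℤ x - w) (swap (col i - col j) e _) ⟩
        toℤ x - e * ((col i - col j) * (toℤ x - toℤ y))
          ≈⟨ ≈-- (≈-refl {a = toℤ x}) (cancel i j i≢j (toℤ x - toℤ y)) ⟩
        toℤ x - (toℤ x - toℤ y)                     ≡⟨ cancelLeft (toℤ x) (toℤ y) ⟩
        toℤ y                                       ∎)
      where b = toℤ (proj₂ (row i j i≢j x y))
            e = proj₁ (inverse i j i≢j)
            regroup : ∀ x i j b → x - i * b + j * b ≡ x - (i - j) * b
            regroup = solve-∀
            swap : ∀ d e z → d * (e * z) ≡ e * (d * z)
            swap = solve-∀
            cancelLeft : ∀ x y → x - (x - y) ≡ y
            cancelLeft = solve-∀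

    -- If two rows agree in columns i and j, then (i - j)(b - b') ≡ 0, so b = b'
    -- and then a = a'.
    unique : ∀ i j → i ≢ j → ∀ r r' → entry r i ≡ entry r' i → entry r j ≡ entry r' j → r ≡ r'
    unique i j i≢j (a , b) (a' , b') eᵢ eⱼ = cong₂ _,_ (canonicalFin a a' a≈a') (canonicalFin b b' b≈b')
      where
        A = toℤ a ; B = toℤ b ; A' = toℤ a' ; B' = toℤ b'
        Pᵢ : A + col i * B ≈[ n ] A' + col i * B'
        Pᵢ = red-injective eᵢ
        Pⱼ : A + col j * B ≈[ n ] A' + col j * B'
        Pⱼ = red-injective eⱼ
        difference : ∀ a i j b → a + i * b - (a + j * b) ≡ (i - j) * b
        difference = solve-∀
        dB : (col i - col j) * B ≈[ n ] (col i - col j) * B'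
        dB = begin
          (col i - col j) * B                   ≡⟨ difference A (col i) (col j) B ⟨
          A + col i * B - (A + col j * B)       ≈⟨ ≈-- Pᵢ Pⱼ ⟩
          A' + col i * B' - (A' + col j * B')   ≡⟨ difference A' (col i) (col j) B' ⟩
          (col i - col j) * B'                  ∎
        b≈b' : B ≈[ n ] B'
        b≈b' = begin
          B                                              ≈⟨ cancel i j i≢j B ⟨
          proj₁ (inverse i j i≢j) * ((col i - col j) * B)   ≈⟨ ≈-*ˡ (proj₁ (inverse i j i≢j)) dB ⟩
          proj₁ (inverse i j i≢j) * ((col i - col j) * B')  ≈⟨ cancel i j i≢j B' ⟩
          B'                                             ∎
        cancelRight : ∀ a w → a + w - w ≡ a
        cancelRight = solve-∀
        a≈a' : A ≈[ n ] A'
        a≈a' = begin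
          A                           ≡⟨ cancelRight A (col i * B) ⟨
          A + col i * B - col i * B   ≈⟨ ≈-- Pᵢ (≈-*ˡ (col i) b≈b') ⟩
          A' + col i * B' - col i * B'  ≡⟨ cancelRight A' (col i * B') ⟩
          A'                          ∎

    linearOA : OA c (Fin n)
    linearOA = record
      { entry = entry ; row = row ; row-i = row-i ; row-j = row-j ; unique = unique }

  module UnitDifferences (c L n : ℕ) (divides : ∀ d → 1 ≤ d → d ≤ c → d ∣ L)
                         (Q : ℤ) (LQ≈1 : + L * Q ≈[ n ] + 1) where

    positiveDifference : ∀ a b → a < b → b ≤ c → Unit n (+ b - + a)
    positiveDifference a b a<b b≤c = + e * Q , ≈-trans (≈-reflexive eq) LQ≈1
      where
        d : ℕ
        d = b ∸ a
        open _∣_ (divides d (ℕP.m<n⇒0<n∸m a<b) (ℕP.≤-trans (ℕP.m∸n≤m b a) b≤c))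
          renaming (quotient to e; equality to L≡ed)
        b≡ : + b ≡ + a + + d
        b≡ = trans (cong +_ (sym (ℕP.m+[n∸m]≡n (ℕP.<⇒≤ a<b)))) (ℤP.pos-+ a d)
        regroup : ∀ a d e q → ((a + d) - a) * (e * q) ≡ (d * e) * q
        regroup = solve-∀
        eq : (+ b - + a) * (+ e * Q) ≡ + L * Q
        eq = begin
          (+ b - + a) * (+ e * Q)            ≡⟨ cong (λ z → (z - + a) * (+ e * Q)) b≡ ⟩
          ((+ a + + d) - + a) * (+ e * Q)    ≡⟨ regroup (+ a) (+ d) (+ e) Q ⟩
          (+ d * + e) * Q
            ≡⟨ cong (_* Q) (trans (sym (ℤP.pos-* d e)) (cong +_ (trans (ℕP.*-comm d e) (sym L≡ed)))) ⟩
          + L * Q                            ∎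
          where open ≡-Reasoning

    below : ∀ {w} → w ≤ suc c → (x : Fin w) → toℕ x ≤ c
    below w≤ x = ℕP.≤-pred (ℕP.≤-trans (FinP.toℕ<n x) w≤)

    -- i - j is ±(a positive difference), hence a unit.
    differences : ∀ {w} → w ≤ suc c → (i j : Fin w) → i ≢ j → Unit n (col i - col j)
    differences w≤ i j i≢j with ℕP.<-cmp (toℕ i) (toℕ j)
    ... | tri< i<j _ _ =
      let (e , p) = positiveDifference (toℕ i) (toℕ j) i<j (below w≤ j)
      in - e , ≈-trans (≈-reflexive (flip (col i) (col j) e)) p
      where flip : ∀ a b x → (a - b) * (- x) ≡ (b - a) * x
            flip = solve-∀
    ... | tri≈ _ i≡j _ = ⊥-elim (i≢j (FinP.toℕ-injective i≡j))
    ... | tri> _ _ j<i = positiveDifference (toℕ j) (toℕ i) j<i (below w≤ i)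


module Cycles where

  open Congruence
  open import Data.Nat using (ℕ; zero; suc; NonZero; _<_)
  import Data.Nat.Properties as ℕP
  open import Data.Integer using (ℤ; +_; _+_; _-_; _*_; -_)
  import Data.Integer.Properties as ℤP
  open import Data.Integer.Tactic.RingSolver using (solve-∀)
  open import Data.Fin using (Fin; toℕ; fromℕ<)
  import Data.Fin.Properties as FinP
  open import Data.Sum using (inj₁; inj₂)
  open import Relation.Binary.PropositionalEquality

  -- Then
  -- q ↦ q + c is a single N-cycle on ℤ/N, and since N ≡ 1 (mod L), for
  -- integer-valued functions on ℤ/N taken modulo L:
  --   (a) if w(q + c) - w(q) ≡ κ for all q, then w is constant (and κ ≡ 0);
  --   (b) every F is, up to an additive constant, of the form w(q + c) - w(q).
  module Cycle (L : ℕ) .{{_ : NonZero L}} (c c' : ℤ) (cc'≈1 : c * c' ≈[ suc L ] + 1) where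

    N : ℕ
    N = suc L

    open Reduction N using (red; toℤ; red-≈; red-cong; red-toℤ)

    N≈1 : ∀ κ → + N * κ ≈[ L ] κ
    N≈1 κ = ≈-sym (mk (- κ) (expand κ (+ L)))
      where expand : ∀ κ l → κ - (+ 1 + l) * κ ≡ - κ * l
            expand = solve-∀

    next : Fin N → Fin N
    next q = red (toℤ q + c)

    point : ℕ → Fin N
    point h = red (+ h * c)

    origin : Fin N
    origin = point 0

    position : Fin N → ℕ
    position q = toℕ (red (toℤ q * c'))

    position<N : ∀ q → position q < N
    position<N q = FinP.toℕ<n (red (toℤ q * c'))

    point-suc : ∀ h → point (suc h) ≡ next (point h)
    point-suc h = red-cong (begin
        (+ 1 + + h) * c            ≡⟨ distrib (+ h) c ⟩
        + h * c + c                ≈⟨ ≈-+ (red-≈ (+ h * c)) (≈-refl {a = c}) ⟨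
        toℤ (point h) + c          ∎)
      where open ≈-Reasoning N
            distrib : ∀ h c → (+ 1 + h) * c ≡ h * c + c
            distrib = solve-∀

    point-N : point N ≡ origin
    point-N = red-cong (≈-trans (≈-reflexive (ℤP.*-comm (+ N) c))
                                (≈-trans (≈-multiple c) (≈-reflexive (sym (ℤP.*-zeroˡ c)))))

    point-position : ∀ q → point (position q) ≡ q
    point-position q = trans (red-cong (begin
        toℤ (red (toℤ q * c')) * c   ≈⟨ ≈-*ʳ c (red-≈ (toℤ q * c')) ⟩
        toℤ q * c' * c               ≡⟨ reassoc (toℤ q) c c' ⟩
        toℤ q * (c * c')             ≈⟨ ≈-*ˡ (toℤ q) cc'≈1 ⟩
        toℤ q * + 1                  ≡⟨ ℤP.*-identityʳ (toℤ q) ⟩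
        toℤ q                        ∎)) (red-toℤ q)
      where open ≈-Reasoning N
            reassoc : ∀ q c c' → q * c' * c ≡ q * (c * c')
            reassoc = solve-∀

    position-next : ∀ q → red (+ suc (position q)) ≡ red (toℤ (next q) * c')
    position-next q = red-cong (begin
        + 1 + + position q                      ≡⟨ ℤP.+-comm (+ 1) (+ position q) ⟩
        + position q + + 1                      ≈⟨ ≈-+ (red-≈ (toℤ q * c')) (≈-sym cc'≈1) ⟩
        toℤ q * c' + c * c'                     ≡⟨ distrib (toℤ q) c c' ⟩
        (toℤ q + c) * c'                        ≈⟨ ≈-*ʳ c' (red-≈ (toℤ q + c)) ⟨
        toℤ (next q) * c'                       ∎)
      where open ≈-Reasoning N
            distrib : ∀ q c c' → q * c' + c * c' ≡ (q + c) * c'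
            distrib = solve-∀

    toℕ-red : ∀ n → n < N → toℕ (red (+ n)) ≡ n
    toℕ-red n n<N = trans (cong (λ m → toℕ (red (+ m))) (sym (FinP.toℕ-fromℕ< n<N)))
                          (trans (cong toℕ (red-toℤ (fromℕ< n<N))) (FinP.toℕ-fromℕ< n<N))

    module ConstantIncrement (w : Fin N → ℤ) (κ : ℤ)
                             (increment : ∀ q → w (next q) - w q ≈[ L ] κ) where
      open ≈-Reasoning L

      walk : ∀ h → w (point h) ≈[ L ] w origin + + h * κ
      walk zero = ≈-reflexive (sym (trans (cong (λ z → w origin + z) (ℤP.*-zeroˡ κ)) (ℤP.+-identityʳ (w origin))))
      walk (suc h) = begin
        w (point (suc h))                         ≡⟨ cong w (point-suc h) ⟩
        w (next (point h))                        ≡⟨ split (w (next (point h))) (w (point h)) ⟩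
        (w (next (point h)) - w (point h)) + w (point h)   ≈⟨ ≈-+ (increment (point h)) (walk h) ⟩
        κ + (w origin + + h * κ)                  ≡⟨ regroup κ (w origin) (+ h) ⟩
        w origin + + suc h * κ                    ∎
        where split : ∀ a b → a ≡ (a - b) + b
              split = solve-∀
              regroup : ∀ κ w h → κ + (w + h * κ) ≡ w + (+ 1 + h) * κ
              regroup = solve-∀

      -- Going once around the cycle: N κ ≡ 0, hence κ ≡ 0.
      increment≈0 : κ ≈[ L ] + 0
      increment≈0 = begin
        κ                                ≈⟨ N≈1 κ ⟨
        + N * κ                          ≡⟨ cancel (w origin) (+ N * κ) ⟨
        w origin + + N * κ - w origin    ≈⟨ ≈-- (walk N) (≈-refl {a = w origin}) ⟨
        w (point N) - w origin           ≡⟨ cong (λ q → w q - w origin) point-N ⟩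
        w origin - w origin              ≡⟨ ℤP.+-inverseʳ (w origin) ⟩
        + 0                              ∎
        where cancel : ∀ a b → a + b - a ≡ b
              cancel = solve-∀

      -- Every point is reached from the origin, with zero total increment.
      constant : ∀ q → w q ≈[ L ] w origin
      constant q = begin
        w q                                    ≡⟨ cong w (point-position q) ⟨
        w (point (position q))                 ≈⟨ walk (position q) ⟩
        w origin + + position q * κ            ≈⟨ ≈-+ (≈-refl {a = w origin}) (≈-*ˡ (+ position q) increment≈0) ⟩
        w origin + + position q * + 0          ≡⟨ vanish (w origin) (+ position q) ⟩
        w origin                               ∎
        where vanish : ∀ a b → a + b * + 0 ≡ a
              vanish = solve-∀

    -- (b) Every F has a potential along the cycle, up to the constant κ:
    -- with κ = -(F(point 0) + ... + F(point L)), the partial sums of F + κ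
    -- along the orbit wrap around consistently modulo L.
    module Potential (F : Fin N → ℤ) where
      open ≈-Reasoning L

      sum : ℕ → ℤ
      sum zero = + 0
      sum (suc h) = sum h + F (point h)

      κ : ℤ
      κ = - sum N

      partial : ℕ → ℤ
      partial zero = + 0
      partial (suc h) = partial h + (F (point h) + κ)

      partial≡ : ∀ h → partial h ≡ sum h + + h * κ
      partial≡ zero = sym (trans (ℤP.+-identityˡ (+ 0 * κ)) (ℤP.*-zeroˡ κ))
      partial≡ (suc h) = trans (cong (_+ (F (point h) + κ)) (partial≡ h)) (regroup (sum h) (+ h) κ (F (point h)))
        where regroup : ∀ s h κ f → s + h * κ + (f + κ) ≡ s + f + (+ 1 + h) * κ
              regroup = solve-∀

      potential : Fin N → ℤ
      potential q = partial (position q)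

      partial-N : partial N ≈[ L ] + 0
      partial-N = begin
        partial N             ≡⟨ partial≡ N ⟩
        sum N + + N * κ       ≈⟨ ≈-+ (≈-refl {a = sum N}) (N≈1 κ) ⟩
        sum N + κ             ≡⟨ ℤP.+-inverseʳ (sum N) ⟩
        + 0                   ∎

      -- A step along the cycle adds F + κ: directly when the position does not
      -- wrap around, and by partial-N at the wrap from position L to 0.
      potential-step : ∀ q → potential (next q) - potential q ≈[ L ] F q + κ
      potential-step q with ℕP.m≤n⇒m<n∨m≡n (position<N q)
      ... | inj₁ inside = begin
        partial (position (next q)) - partial (position q)   ≡⟨ cong (λ h → partial h - partial (position q)) next-position ⟩
        partial (suc (position q)) - partial (position q)    ≡⟨ cancel (partial (position q)) (F (point (position q)) + κ) ⟩
        F (point (position q)) + κ                           ≡⟨ cong (λ p → F p + κ) (point-position q) ⟩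
        F q + κ                                              ∎
        where
          next-position : position (next q) ≡ suc (position q)
          next-position = trans (cong toℕ (sym (position-next q))) (toℕ-red (suc (position q)) inside)
          cancel : ∀ s x → s + x - s ≡ x
          cancel = solve-∀
      ... | inj₂ wraps = begin
        partial (position (next q)) - partial (position q)   ≡⟨ cong (λ h → partial h - partial (position q)) next-position ⟩
        + 0 - partial (position q)                          ≡⟨ rearrange (partial (position q)) (F q + κ) ⟩
        (F q + κ) - (partial (position q) + (F q + κ))      ≡⟨ cong (λ z → (F q + κ) - z) (sym last-step) ⟩
        (F q + κ) - partial N                               ≈⟨ ≈-- (≈-refl {a = F q + κ}) partial-N ⟩
        (F q + κ) - + 0                                     ≡⟨ ℤP.+-identityʳ (F q + κ) ⟩
        F q + κ                                             ∎
        where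
          next-position : position (next q) ≡ 0
          next-position = trans (cong toℕ (sym (position-next q)))
            (trans (cong (λ h → toℕ (red (+ h))) wraps)
                   (cong toℕ (red-cong (≈-trans (≈-reflexive (sym (ℤP.*-identityˡ (+ N)))) (≈-multiple (+ 1))))))
          last-step : partial N ≡ partial (position q) + (F q + κ)
          last-step = trans (cong partial (sym wraps)) (cong (λ p → partial (position q) + (F p + κ)) (point-position q))
          rearrange : ∀ s x → + 0 - s ≡ x - (s + x)
          rearrange = solve-∀


module ShiftArrays where

  open Congruence
  open OrthogonalArrays
  open Linear using (Unit; col)
  open Cycles using (module Cycle)
  open import Data.Nat using (ℕ; zero; suc; NonZero; _^_)
  open import Data.Integer using (ℤ; +_; _+_; _-_; -_)
  import Data.Integer.Properties as ℤP
  open import Data.Integer.Tactic.RingSolver using (solve-∀)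
  open import Data.Fin using (Fin; zero; suc; combine; funToFin; finToFun)
  import Data.Fin.Properties as FinP
  open import Data.Product using (_×_; _,_; proj₁; proj₂)
  open import Relation.Binary.Bundles using (Setoid)
  import Relation.Binary.Reasoning.Setoid as SetoidReasoning
  open import Relation.Binary.PropositionalEquality

  funToFin-cong : ∀ {m n} {f g : Fin m → Fin n} → (∀ q → f q ≡ g q) → funToFin f ≡ funToFin g
  funToFin-cong {zero} e = refl
  funToFin-cong {suc m} e = cong₂ combine (e zero) (funToFin-cong (λ q → e (suc q)))

  -- An orthogonal array on L^L symbols with an idempotent row, for every L ≥ 1
  -- such that the column differences are invertible modulo N = L + 1.
  -- The symbols are the functions ℤ/N → ℤ/L modulo constants (a group of
  -- order L^L); column i shifts the argument by i, and row (x , y) has entry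
  -- x + shiftᵢ y in column i.  By Cycle, shiftᵢ - shiftⱼ is a bijection of
  -- this group whenever i - j is invertible modulo N.
  module ShiftArray (k L : ℕ) .{{_ : NonZero L}}
                    (inverse : (i j : Fin k) → i ≢ j → Unit (suc L) (col i - col j)) where

    N : ℕ
    N = suc L

    module ModN = Reduction N
    module ModL = Reduction L

    Vec : Set
    Vec = Fin N → ℤ

    infix 4 _~_
    record _~_ (w w' : Vec) : Set where
      constructor const-diff
      field
        offset : ℤ
        diff   : ∀ p → w p - w' p ≈[ L ] offset

    ~-refl : ∀ {w} → w ~ w
    ~-refl {w} = const-diff (+ 0) (λ p → ≈-reflexive (ℤP.+-inverseʳ (w p)))

    ~-sym : ∀ {w w'} → w ~ w' → w' ~ w
    ~-sym {w} {w'} (const-diff κ d) =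
      const-diff (- κ) (λ p → ≈-trans (≈-reflexive (swap (w p) (w' p))) (≈-neg (d p)))
      where swap : ∀ a b → b - a ≡ - (a - b)
            swap = solve-∀

    ~-trans : ∀ {u v w} → u ~ v → v ~ w → u ~ w
    ~-trans {u} {v} {w} (const-diff κ d) (const-diff μ e) =
      const-diff (κ + μ) (λ p → ≈-trans (≈-reflexive (split (u p) (v p) (w p))) (≈-+ (d p) (e p)))
      where split : ∀ a b c → a - c ≡ (a - b) + (b - c)
            split = solve-∀

    ~-setoid : Setoid _ _
    ~-setoid = record
      { Carrier = Vec ; _≈_ = _~_
      ; isEquivalence = record { refl = ~-refl ; sym = ~-sym ; trans = ~-trans } }

    module ~-Reasoning = SetoidReasoning ~-setoid

    pointwise : ∀ {w w'} → (∀ p → w p ≡ w' p) → w ~ w'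
    pointwise {w} e = const-diff (+ 0) (λ p → ≈-reflexive (trans (cong (λ z → w p - z) (sym (e p))) (ℤP.+-inverseʳ (w p))))

    infixl 6 _⊕_ _⊖_
    _⊕_ : Vec → Vec → Vec
    (u ⊕ v) p = u p + v p

    _⊖_ : Vec → Vec → Vec
    (u ⊖ v) p = u p - v p

    zeroV : Vec
    zeroV p = + 0

    ~-⊕ : ∀ {u u' v v'} → u ~ u' → v ~ v' → u ⊕ v ~ u' ⊕ v'
    ~-⊕ {u} {u'} {v} {v'} (const-diff κ d) (const-diff μ e) =
      const-diff (κ + μ) (λ p → ≈-trans (≈-reflexive (regroup (u p) (u' p) (v p) (v' p))) (≈-+ (d p) (e p)))
      where regroup : ∀ a a' b b' → a + b - (a' + b') ≡ (a - a') + (b - b')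
            regroup = solve-∀

    ~-⊖ : ∀ {u u' v v'} → u ~ u' → v ~ v' → u ⊖ v ~ u' ⊖ v'
    ~-⊖ {u} {u'} {v} {v'} (const-diff κ d) (const-diff μ e) =
      const-diff (κ - μ) (λ p → ≈-trans (≈-reflexive (regroup (u p) (u' p) (v p) (v' p))) (≈-- (d p) (e p)))
      where regroup : ∀ a a' b b' → a - b - (a' - b') ≡ (a - a') - (b - b')
            regroup = solve-∀

    shift : Fin k → Vec → Vec
    shift i w p = w (ModN.red (ModN.toℤ p + col i))

    ~-shift : ∀ i {u u'} → u ~ u' → shift i u ~ shift i u'
    ~-shift i (const-diff κ d) = const-diff κ (λ p → d _)

    -- Canonical codes: a vector modulo ~ is determined by its differences
    -- w(q + 1) - w(0) modulo L, q < L, which form a function Fin L → Fin L,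
    -- i.e. an element of Fin (L ^ L).
    Code : Set
    Code = Fin (L ^ L)

    normal : Vec → (Fin L → Fin L)
    normal w q = ModL.red (w (suc q) - w zero)

    lift : (Fin L → Fin L) → Vec
    lift f zero = + 0
    lift f (suc q) = ModL.toℤ (f q)

    code : Vec → Code
    code w = funToFin (normal w)

    decode : Code → Vec
    decode x = lift (finToFun x)

    normal-cong : ∀ {w w'} → w ~ w' → ∀ q → normal w q ≡ normal w' q
    normal-cong {w} {w'} (const-diff κ d) q = ModL.red-cong (begin
        w (suc q) - w zero                                        ≡⟨ regroup (w (suc q)) (w zero) (w' (suc q)) (w' zero) ⟩
        ((w (suc q) - w' (suc q)) - (w zero - w' zero)) + (w' (suc q) - w' zero)
                                                                  ≈⟨ ≈-+ (≈-- (d (suc q)) (d zero)) (≈-refl {a = w' (suc q) - w' zero}) ⟩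
        κ - κ + (w' (suc q) - w' zero)                            ≡⟨ cancel κ (w' (suc q) - w' zero) ⟩
        w' (suc q) - w' zero                                      ∎)
      where
        open ≈-Reasoning L
        regroup : ∀ a b a' b' → a - b ≡ ((a - a') - (b - b')) + (a' - b')
        regroup = solve-∀
        cancel : ∀ κ x → κ - κ + x ≡ x
        cancel = solve-∀

    lift-normal : ∀ w → lift (normal w) ~ w
    lift-normal w = const-diff (- w zero) diff
      where
        diff : ∀ p → lift (normal w) p - w p ≈[ L ] - w zero
        diff zero = ≈-reflexive (ℤP.+-identityˡ (- w zero))
        diff (suc q) = ≈-trans (≈-- (ModL.red-≈ (w (suc q) - w zero)) (≈-refl {a = w (suc q)}))
                               (≈-reflexive (cancel (w (suc q)) (w zero)))
          where cancel : ∀ a b → a - b - a ≡ - b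
                cancel = solve-∀

    normal-lift : ∀ f q → normal (lift f) q ≡ f q
    normal-lift f q = trans (cong ModL.red (ℤP.+-identityʳ (ModL.toℤ (f q)))) (ModL.red-toℤ (f q))

    code-cong : ∀ {w w'} → w ~ w' → code w ≡ code w'
    code-cong w~w' = funToFin-cong (normal-cong w~w')

    code-decode : ∀ x → code (decode x) ≡ x
    code-decode x = trans (funToFin-cong (normal-lift (finToFun x))) (FinP.funToFin-finToFin {L} {L} x)

    decode-code : ∀ w → decode (code w) ~ w
    decode-code w = ~-trans (pointwise (lift-cong (FinP.finToFun-funToFin (normal w)))) (lift-normal w)
      where
        lift-cong : ∀ {f g} → (∀ q → f q ≡ g q) → ∀ p → lift f p ≡ lift g p
        lift-cong e zero = refl
        lift-cong e (suc q) = cong ModL.toℤ (e q)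

    code-injective : ∀ {w w'} → code w ≡ code w' → w ~ w'
    code-injective {w} {w'} e =
      ~-trans (~-sym (decode-code w)) (~-trans (pointwise (λ p → cong (λ x → decode x p) e)) (decode-code w'))

    decode-injective : ∀ {x y} → decode x ~ decode y → x ≡ y
    decode-injective {x} {y} d = trans (sym (code-decode x)) (trans (code-cong d) (code-decode y))

    -- For i ≠ j, the map w ↦ shiftᵢ w ⊖ shiftⱼ w is a bijection modulo ~:
    -- up to the substitution p = q - j it is w ↦ w(q + (i - j)) - w(q).
    module TwoColumns (i j : Fin k) (i≢j : i ≢ j) where
      open ModN using (red; toℤ; red-≈; red-cong; red-toℤ)
      open Cycle L (col i - col j) (proj₁ (inverse i j i≢j)) (proj₂ (inverse i j i≢j)) hiding (N)

      shift-i : ∀ p → red (toℤ p + col i) ≡ next (red (toℤ p + col j))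
      shift-i p = red-cong (begin
          toℤ p + col i                            ≡⟨ regroup (toℤ p) (col i) (col j) ⟩
          toℤ p + col j + (col i - col j)          ≈⟨ ≈-+ (red-≈ (toℤ p + col j)) (≈-refl {a = col i - col j}) ⟨
          toℤ (red (toℤ p + col j)) + (col i - col j)   ∎)
        where open ≈-Reasoning N
              regroup : ∀ p i j → p + i ≡ p + j + (i - j)
              regroup = solve-∀

      unshift : ∀ q → red (toℤ (red (toℤ q - col j)) + col j) ≡ q
      unshift q = trans (red-cong (begin
          toℤ (red (toℤ q - col j)) + col j   ≈⟨ ≈-+ (red-≈ (toℤ q - col j)) (≈-refl {a = col j}) ⟩
          toℤ q - col j + col j               ≡⟨ cancel (toℤ q) (col j) ⟩
          toℤ q                               ∎)) (red-toℤ q)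
        where open ≈-Reasoning N
              cancel : ∀ q j → q - j + j ≡ q
              cancel = solve-∀

      -- A vector in the kernel has constant increments along the cycle, so it
      -- is constant.
      difference-injective : ∀ w → shift i w ⊖ shift j w ~ zeroV → w ~ zeroV
      difference-injective w (const-diff κ d) =
        const-diff (w origin) (λ q → ≈-trans (≈-reflexive (ℤP.+-identityʳ (w q))) (constant q))
        where
          increment : ∀ q → w (next q) - w q ≈[ L ] κ
          increment q = ≈-trans (≈-reflexive (sym (trans (ℤP.+-identityʳ _)
                          (cong₂ (λ a b → w a - w b) (trans (shift-i p) (cong next (unshift q))) (unshift q)))))
                        (d p)
            where p = red (toℤ q - col j)
          open ConstantIncrement w κ increment using (constant)

      solution : Vec → Vec
      solution D = Potential.potential (λ q → D (red (toℤ q - col j)))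

      difference-surjective : ∀ D → shift i (solution D) ⊖ shift j (solution D) ~ D
      difference-surjective D = const-diff κ diff
        where
          F : Fin N → ℤ
          F q = D (red (toℤ q - col j))
          open Potential F using (κ; potential; potential-step)
          diff : ∀ p → potential (red (toℤ p + col i)) - potential (red (toℤ p + col j)) - D p ≈[ L ] κ
          diff p = begin
            potential (red (toℤ p + col i)) - potential q - D p   ≡⟨ cong (λ r → potential r - potential q - D p) (shift-i p) ⟩
            potential (next q) - potential q - D p                ≈⟨ ≈-- (potential-step q) (≈-reflexive (sym Fq)) ⟩
            F q + κ - F q                                         ≡⟨ cancel (F q) κ ⟩
            κ                                                     ∎
            where
              open ≈-Reasoning L
              q = red (toℤ p + col j)
              Fq : F q ≡ D p
              Fq = cong D (trans (red-cong (≈-trans (≈-- (red-≈ (toℤ p + col j)) (≈-refl {a = col j}))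
                                                    (≈-reflexive (cancelj (toℤ p) (col j)))))
                                 (red-toℤ p))
                where cancelj : ∀ p j → p + j - j ≡ p
                      cancelj = solve-∀
              cancel : ∀ d κ → d + κ - d ≡ κ
              cancel = solve-∀

    open TwoColumns using (solution; difference-surjective; difference-injective)
    open ~-Reasoning

    entry : Code × Code → Fin k → Code
    entry (x , y) i = code (decode x ⊕ shift i (decode y))

    row : (i j : Fin k) → i ≢ j → Code → Code → Code × Code
    row i j i≢j x y = code (decode x ⊖ shift i b) , code b
      where b = solution i j i≢j (decode x ⊖ decode y)

    entry-code : ∀ a b c → entry (code a , code b) c ≡ code (a ⊕ shift c b)
    entry-code a b c = code-cong (~-⊕ (decode-code a) (~-shift c (decode-code b)))

    row-i : ∀ i j i≢j x y → entry (row i j i≢j x y) i ≡ x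
    row-i i j i≢j x y = trans (entry-code (decode x ⊖ shift i b) b i)
      (trans (code-cong (pointwise λ p → cancelRight (decode x p) (shift i b p))) (code-decode x))
      where
        b = solution i j i≢j (decode x ⊖ decode y)
        cancelRight : ∀ a b → a - b + b ≡ a
        cancelRight = solve-∀

    row-j : ∀ i j i≢j x y → entry (row i j i≢j x y) j ≡ y
    row-j i j i≢j x y = trans (entry-code (decode x ⊖ shift i b) b j) (trans (code-cong j-column) (code-decode y))
      where
        b = solution i j i≢j (decode x ⊖ decode y)
        regroup : ∀ a b b' → a - b + b' ≡ a - (b - b')
        regroup = solve-∀
        cancelLeft : ∀ a b → a - (a - b) ≡ b
        cancelLeft = solve-∀
        j-column : decode x ⊖ shift i b ⊕ shift j b ~ decode y
        j-column = begin
          decode x ⊖ shift i b ⊕ shift j b       ≈⟨ pointwise (λ p → regroup (decode x p) (shift i b p) (shift j b p)) ⟩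
          decode x ⊖ (shift i b ⊖ shift j b)
            ≈⟨ ~-⊖ (~-refl {decode x}) (difference-surjective i j i≢j (decode x ⊖ decode y)) ⟩
          decode x ⊖ (decode x ⊖ decode y)       ≈⟨ pointwise (λ p → cancelLeft (decode x p) (decode y p)) ⟩
          decode y                               ∎

    agreeing-rows : ∀ i j A B A' B' → A ⊕ shift i B ~ A' ⊕ shift i B' → A ⊕ shift j B ~ A' ⊕ shift j B' →
                    shift i (B ⊖ B') ⊖ shift j (B ⊖ B') ~ zeroV
    agreeing-rows i j A B A' B' Pᵢ Pⱼ = begin
        shift i (B ⊖ B') ⊖ shift j (B ⊖ B')
          ≈⟨ pointwise (λ p → differences (A p) (A' p) (shift i B p) (shift i B' p) (shift j B p) (shift j B' p)) ⟩
        (A ⊕ shift i B ⊖ (A' ⊕ shift i B')) ⊖ (A ⊕ shift j B ⊖ (A' ⊕ shift j B'))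
          ≈⟨ ~-⊖ (~-⊖ Pᵢ (~-refl {A' ⊕ shift i B'})) (~-⊖ Pⱼ (~-refl {A' ⊕ shift j B'})) ⟩
        (A' ⊕ shift i B' ⊖ (A' ⊕ shift i B')) ⊖ (A' ⊕ shift j B' ⊖ (A' ⊕ shift j B'))
          ≈⟨ pointwise (λ p → vanish (A' p + shift i B' p) (A' p + shift j B' p)) ⟩
        zeroV ∎
      where
        differences : ∀ a a' x x' y y' → x - x' - (y - y') ≡ ((a + x) - (a' + x')) - ((a + y) - (a' + y'))
        differences = solve-∀
        vanish : ∀ u v → u - u - (v - v) ≡ + 0
        vanish = solve-∀

    -- Rows agreeing in columns i and j have b ⊖ b' in the kernel of
    -- shiftᵢ - shiftⱼ, so b = b', and then a = a'.
    unique : ∀ i j → i ≢ j → ∀ r r' → entry r i ≡ entry r' i → entry r j ≡ entry r' j → r ≡ r'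
    unique i j i≢j (a , b) (a' , b') eᵢ eⱼ = cong₂ _,_ (decode-injective A~A') (decode-injective B~B')
      where
        A = decode a ; B = decode b ; A' = decode a' ; B' = decode b'
        Pᵢ : A ⊕ shift i B ~ A' ⊕ shift i B'
        Pᵢ = code-injective eᵢ
        kernel : shift i (B ⊖ B') ⊖ shift j (B ⊖ B') ~ zeroV
        kernel = agreeing-rows i j A B A' B' Pᵢ (code-injective eⱼ)
        addBack : ∀ x y → x ≡ x - y + y
        addBack = solve-∀
        B~B' : B ~ B'
        B~B' = begin
          B                  ≈⟨ pointwise (λ p → addBack (B p) (B' p)) ⟩
          B ⊖ B' ⊕ B'        ≈⟨ ~-⊕ (difference-injective i j i≢j (B ⊖ B') kernel) (~-refl {B'}) ⟩
          zeroV ⊕ B'         ≈⟨ pointwise (λ p → ℤP.+-identityˡ (B' p)) ⟩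
          B'                 ∎
        takeAway : ∀ x y → x ≡ x + y - y
        takeAway = solve-∀
        A~A' : A ~ A'
        A~A' = begin
          A                             ≈⟨ pointwise (λ p → takeAway (A p) (shift i B p)) ⟩
          A ⊕ shift i B ⊖ shift i B     ≈⟨ ~-⊖ Pᵢ (~-shift i B~B') ⟩
          A' ⊕ shift i B' ⊖ shift i B'  ≈⟨ pointwise (λ p → takeAway (A' p) (shift i B' p)) ⟨
          A'                            ∎

    shiftOA : OA k Code
    shiftOA = record
      { entry = entry ; row = row ; row-i = row-i ; row-j = row-j ; unique = unique }

    idempotent : ∀ i → entry (code zeroV , code zeroV) i ≡ code zeroV
    idempotent i = trans (entry-code zeroV zeroV i) (code-cong (pointwise {zeroV ⊕ shift i zeroV} {zeroV} (λ p → refl)))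


module Wilson where

  open OrthogonalArrays
  open import Data.Nat using (ℕ; suc; _≤_; _<_; _<?_; _*_; _+_)
  import Data.Nat.Properties as ℕP
  open import Data.Fin using (Fin; zero; suc; toℕ; fromℕ; fromℕ<; inject₁; inject≤; _≟_)
  open import Data.Fin.Permutation using (transpose)
  import Data.Fin.Properties as FinP
  open import Data.Maybe using (Maybe; just; nothing)
  open import Data.Product using (Σ; _×_; _,_)
  open import Data.Product.Properties using (,-injectiveˡ; ,-injectiveʳ)
  open import Data.Sum using (_⊎_; inj₁; inj₂)
  open import Data.Sum.Properties using (inj₁-injective; inj₂-injective)
  open import Data.Sum.Function.Propositional using (_⊎-↔_)
  open import Data.Empty using (⊥; ⊥-elim)
  open import Function.Bundles using (_↔_; Inverse; mk↔ₛ′)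
  open import Function.Properties.Inverse using (↔-refl; ↔-sym; ↔-trans)
  open import Relation.Nullary using (Dec; yes; no)
  open import Relation.Nullary.Decidable using (dec-true)
  open import Relation.Binary.PropositionalEquality

  finSuc↔Maybe : ∀ {m} → Fin (suc m) ↔ Maybe (Fin m)
  finSuc↔Maybe = mk↔ₛ′ toMaybe fromMaybe (λ { nothing → refl ; (just x) → refl })
                                          (λ { zero → refl ; (suc x) → refl })
    where
      toMaybe : ∀ {m} → Fin (suc m) → Maybe (Fin m)
      toMaybe zero = nothing
      toMaybe (suc x) = just x
      fromMaybe : ∀ {m} → Maybe (Fin m) → Fin (suc m)
      fromMaybe nothing = zero
      fromMaybe (just x) = suc x

  pointAtInfinity : ∀ {k n m} → n ≡ suc m → (O : OA k (Fin n)) (z : Fin n) →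
                    (∀ i → OrthogonalArray.entry O (z , z) i ≡ z) →
                    Σ (OA k (Maybe (Fin m))) λ O' → ∀ i → OrthogonalArray.entry O' (nothing , nothing) i ≡ nothing
  pointAtInfinity {m = m} refl O z idem =
    relabel σ O , subst (λ ∞ → ∀ i → OrthogonalArray.entry (relabel σ O) (∞ , ∞) i ≡ ∞)
                        z↦nothing (relabel-idempotent σ O idem)
    where
      σ : Fin (suc m) ↔ Maybe (Fin m)
      σ = ↔-trans (transpose z zero) finSuc↔Maybe
      z↦nothing : Inverse.to σ z ≡ nothing
      z↦nothing rewrite dec-true (z ≟ z) refl = refl

  -- Truncate the last column of T to the first u symbols.  Every row ρ of T
  -- whose last entry is not kept is blown up by M (`big` rows); every row whose
  -- last entry z is kept is blown up by the non-idle rows of M₁, with ∞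
  -- replaced by z (`small` rows); U supplies the rows inside Fin u (`inner`).
  module Construction (k' t m u : ℕ) (u≤t : u ≤ t)
                      (T : OA (suc (suc (suc k'))) (Fin t))
                      (M : OA (suc (suc k')) (Fin m))
                      (M₁ : OA (suc (suc k')) (Maybe (Fin m)))
                      (idle : ∀ i → OrthogonalArray.entry M₁ (nothing , nothing) i ≡ nothing)
                      (U : OA (suc (suc k')) (Fin u)) where

    k : ℕ
    k = suc (suc k')

    module T = OrthogonalArray T
    module M = OrthogonalArray M
    module M₁ = OrthogonalArray M₁
    module U = OrthogonalArray U

    Symbol : Set
    Symbol = (Fin t × Fin m) ⊎ Fin u

    column : Fin k → Fin (suc k)
    column = inject₁

    last : Fin (suc k)
    last = fromℕ k

    column≢last : ∀ i → column i ≢ last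
    column≢last i e = FinP.fromℕ≢inject₁ (sym e)

    last≢column : ∀ j → last ≢ column j
    last≢column j e = column≢last j (sym e)

    column≢column : ∀ {i j} → i ≢ j → column i ≢ column j
    column≢column i≢j e = i≢j (FinP.inject₁-injective e)

    lastEntry : Fin t × Fin t → ℕ
    lastEntry ρ = toℕ (T.entry ρ last)

    embed : Fin u → Fin t
    embed z = inject≤ z u≤t

    kept : ∀ ρ z → T.entry ρ last ≡ embed z → lastEntry ρ < u
    kept ρ z e = subst (_< u) (sym (trans (cong toℕ e) (FinP.toℕ-inject≤ z u≤t))) (FinP.toℕ<n z)

    keptPoint : ∀ ρ z (p : lastEntry ρ < u) → T.entry ρ last ≡ embed z → fromℕ< p ≡ z
    keptPoint ρ z p e =
      FinP.toℕ-injective (trans (FinP.toℕ-fromℕ< p) (trans (cong toℕ e) (FinP.toℕ-inject≤ z u≤t)))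

    -- The non-idle rows of M₁.
    data Active : Set where
      justˡ : Fin m → Maybe (Fin m) → Active
      justʳ : Fin m → Active

    pair : Active → Maybe (Fin m) × Maybe (Fin m)
    pair (justˡ a b) = just a , b
    pair (justʳ b) = nothing , just b

    pair-injective : ∀ {ν μ} → pair ν ≡ pair μ → ν ≡ μ
    pair-injective {justˡ a b} {justˡ .a .b} refl = refl
    pair-injective {justʳ b} {justʳ .b} refl = refl

    activate : (r : Maybe (Fin m) × Maybe (Fin m)) → r ≢ (nothing , nothing) → Active
    activate (just a , b) _ = justˡ a b
    activate (nothing , just b) _ = justʳ b
    activate (nothing , nothing) r≢idle = ⊥-elim (r≢idle refl)

    pair-activate : ∀ r r≢idle → pair (activate r r≢idle) ≡ r
    pair-activate (just a , b) _ = refl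
    pair-activate (nothing , just b) _ = refl
    pair-activate (nothing , nothing) r≢idle = ⊥-elim (r≢idle refl)

    activeEntry : Active → Fin k → Maybe (Fin m)
    activeEntry ν = M₁.entry (pair ν)

    -- An active row has no two ∞ entries, since the idle row is the only row
    -- with ∞ in two given columns.
    active-not-idle : ∀ ν {i j} → i ≢ j → activeEntry ν i ≡ nothing → activeEntry ν j ≡ nothing → ⊥
    active-not-idle ν {i} {j} i≢j eᵢ eⱼ =
      not-idle ν (M₁.unique i j i≢j (pair ν) (nothing , nothing) (trans eᵢ (sym (idle i))) (trans eⱼ (sym (idle j))))
      where not-idle : ∀ ν → pair ν ≢ (nothing , nothing)
            not-idle (justˡ a b) ()
            not-idle (justʳ b) ()

    activeRow : ∀ i j → i ≢ j → ∀ a b → (a ≢ nothing) ⊎ (b ≢ nothing) → Active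
    activeRow i j i≢j a b finite = activate r (not-idle finite)
      where
        r : Maybe (Fin m) × Maybe (Fin m)
        r = M₁.row i j i≢j a b
        not-idle : (a ≢ nothing) ⊎ (b ≢ nothing) → r ≢ (nothing , nothing)
        not-idle (inj₁ a≢∞) e = a≢∞ (trans (sym (M₁.row-i i j i≢j a b)) (trans (cong (λ r → M₁.entry r i) e) (idle i)))
        not-idle (inj₂ b≢∞) e = b≢∞ (trans (sym (M₁.row-j i j i≢j a b)) (trans (cong (λ r → M₁.entry r j) e) (idle j)))

    activeRow-i : ∀ i j i≢j a b finite → activeEntry (activeRow i j i≢j a b finite) i ≡ a
    activeRow-i i j i≢j a b finite = trans (cong (λ r → M₁.entry r i) (pair-activate _ _)) (M₁.row-i i j i≢j a b)

    activeRow-j : ∀ i j i≢j a b finite → activeEntry (activeRow i j i≢j a b finite) j ≡ b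
    activeRow-j i j i≢j a b finite = trans (cong (λ r → M₁.entry r j) (pair-activate _ _)) (M₁.row-j i j i≢j a b)

    just≢nothing : ∀ {a : Fin m} → just a ≢ nothing
    just≢nothing ()

    fill : Fin t → Fin u → Maybe (Fin m) → Symbol
    fill g z (just γ) = inj₁ (g , γ)
    fill g z nothing = inj₂ z

    data Row : Set where
      big   : (ρ : Fin t × Fin t) → u ≤ lastEntry ρ → Fin m × Fin m → Row
      small : (ρ : Fin t × Fin t) → lastEntry ρ < u → Active → Row
      inner : Fin u × Fin u → Row

    entry : Row → Fin k → Symbol
    entry (big ρ _ σ) i = inj₁ (T.entry ρ (column i) , M.entry σ i)
    entry (small ρ p ν) i = fill (T.entry ρ (column i)) (fromℕ< p) (activeEntry ν i)
    entry (inner τ) i = inj₂ (U.entry τ i)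

    small-just : ∀ ρ p ν c {g γ} → T.entry ρ (column c) ≡ g → activeEntry ν c ≡ just γ →
                 entry (small ρ p ν) c ≡ inj₁ (g , γ)
    small-just ρ p ν c refl e = cong (fill _ (fromℕ< p)) e

    small-nothing : ∀ ρ p ν c {z} → T.entry ρ last ≡ embed z → activeEntry ν c ≡ nothing →
                    entry (small ρ p ν) c ≡ inj₂ z
    small-nothing ρ p ν c {z} eₗ e = trans (cong (fill _ (fromℕ< p)) e) (cong inj₂ (keptPoint ρ z p eₗ))

    overBlock : (ρ : Fin t × Fin t) → Dec (lastEntry ρ < u) → Active → Fin m × Fin m → Row
    overBlock ρ (yes kept) ν σ = small ρ kept ν
    overBlock ρ (no dropped) ν σ = big ρ (ℕP.≮⇒≥ dropped) σ

    overBlock-entry : ∀ ρ d ν σ c {g γ} → T.entry ρ (column c) ≡ g → activeEntry ν c ≡ just γ →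
                      M.entry σ c ≡ γ → entry (overBlock ρ d ν σ) c ≡ inj₁ (g , γ)
    overBlock-entry ρ (yes p) ν σ c eₜ eₐ eₘ = small-just ρ p ν c eₜ eₐ
    overBlock-entry ρ (no p) ν σ c eₜ eₐ eₘ = cong inj₁ (cong₂ _,_ eₜ eₘ)

    module ThroughBoth (i j : Fin k) (i≢j : i ≢ j) (g g' : Fin t) (α β : Fin m) where
      ρ : Fin t × Fin t
      ρ = T.row (column i) (column j) (column≢column i≢j) g g'
      ν : Active
      ν = activeRow i j i≢j (just α) (just β) (inj₁ just≢nothing)
      σ : Fin m × Fin m
      σ = M.row i j i≢j α β

      through : Row
      through = overBlock ρ (lastEntry ρ <? u) ν σ

      at-i : entry through i ≡ inj₁ (g , α)
      at-i = overBlock-entry ρ (lastEntry ρ <? u) ν σ i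
               (T.row-i _ _ (column≢column i≢j) g g')
               (activeRow-i i j i≢j (just α) (just β) (inj₁ just≢nothing))
               (M.row-i i j i≢j α β)

      at-j : entry through j ≡ inj₁ (g' , β)
      at-j = overBlock-entry ρ (lastEntry ρ <? u) ν σ j
               (T.row-j _ _ (column≢column i≢j) g g')
               (activeRow-j i j i≢j (just α) (just β) (inj₁ just≢nothing))
               (M.row-j i j i≢j α β)

    module ThroughKept (i j : Fin k) (i≢j : i ≢ j) (g : Fin t) (α : Fin m) (z : Fin u) where
      ρ : Fin t × Fin t
      ρ = T.row (column i) last (column≢last i) g (embed z)
      ν : Active
      ν = activeRow i j i≢j (just α) nothing (inj₁ just≢nothing)
      p : lastEntry ρ < u
      p = kept ρ z (T.row-j _ _ (column≢last i) g (embed z))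

      through : Row
      through = small ρ p ν

      at-i : entry through i ≡ inj₁ (g , α)
      at-i = small-just ρ p ν i
               (T.row-i _ _ (column≢last i) g (embed z))
               (activeRow-i i j i≢j (just α) nothing (inj₁ just≢nothing))

      at-j : entry through j ≡ inj₂ z
      at-j = small-nothing ρ p ν j
               (T.row-j _ _ (column≢last i) g (embed z))
               (activeRow-j i j i≢j (just α) nothing (inj₁ just≢nothing))

    module KeptThrough (i j : Fin k) (i≢j : i ≢ j) (z : Fin u) (g : Fin t) (α : Fin m) where
      ρ : Fin t × Fin t
      ρ = T.row last (column j) (last≢column j) (embed z) g
      ν : Active
      ν = activeRow i j i≢j nothing (just α) (inj₂ just≢nothing)
      p : lastEntry ρ < u
      p = kept ρ z (T.row-i _ _ (last≢column j) (embed z) g)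

      through : Row
      through = small ρ p ν

      at-i : entry through i ≡ inj₂ z
      at-i = small-nothing ρ p ν i
               (T.row-i _ _ (last≢column j) (embed z) g)
               (activeRow-i i j i≢j nothing (just α) (inj₂ just≢nothing))

      at-j : entry through j ≡ inj₁ (g , α)
      at-j = small-just ρ p ν j
               (T.row-j _ _ (last≢column j) (embed z) g)
               (activeRow-j i j i≢j nothing (just α) (inj₂ just≢nothing))

    row : (i j : Fin k) → i ≢ j → Symbol → Symbol → Row
    row i j i≢j (inj₁ (g , α)) (inj₁ (g' , β)) = ThroughBoth.through i j i≢j g g' α β
    row i j i≢j (inj₁ (g , α)) (inj₂ z)         = ThroughKept.through i j i≢j g α z
    row i j i≢j (inj₂ z)       (inj₁ (g , α))  = KeptThrough.through i j i≢j z g α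
    row i j i≢j (inj₂ z)       (inj₂ z')        = inner (U.row i j i≢j z z')

    row-i : ∀ i j i≢j x y → entry (row i j i≢j x y) i ≡ x
    row-i i j i≢j (inj₁ (g , α)) (inj₁ (g' , β)) = ThroughBoth.at-i i j i≢j g g' α β
    row-i i j i≢j (inj₁ (g , α)) (inj₂ z)         = ThroughKept.at-i i j i≢j g α z
    row-i i j i≢j (inj₂ z)       (inj₁ (g , α))  = KeptThrough.at-i i j i≢j z g α
    row-i i j i≢j (inj₂ z)       (inj₂ z')        = cong inj₂ (U.row-i i j i≢j z z')

    row-j : ∀ i j i≢j x y → entry (row i j i≢j x y) j ≡ y
    row-j i j i≢j (inj₁ (g , α)) (inj₁ (g' , β)) = ThroughBoth.at-j i j i≢j g g' α β
    row-j i j i≢j (inj₁ (g , α)) (inj₂ z)         = ThroughKept.at-j i j i≢j g α z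
    row-j i j i≢j (inj₂ z)       (inj₁ (g , α))  = KeptThrough.at-j i j i≢j z g α
    row-j i j i≢j (inj₂ z)       (inj₂ z')        = cong inj₂ (U.row-j i j i≢j z z')

    small-inj₁ : ∀ ρ p ν c {g γ} → entry (small ρ p ν) c ≡ inj₁ (g , γ) → T.entry ρ (column c) ≡ g
    small-inj₁ ρ p ν c e with activeEntry ν c
    ... | just _ = ,-injectiveˡ (inj₁-injective e)

    small-inj₂ : ∀ ρ p ν c {z} → entry (small ρ p ν) c ≡ inj₂ z → activeEntry ν c ≡ nothing
    small-inj₂ ρ p ν c e with activeEntry ν c
    ... | nothing = refl

    data Agreement (ρ ρ' : Fin t × Fin t) (ν ν' : Active) (c : Fin k) : Set where
      through-column : T.entry ρ (column c) ≡ T.entry ρ' (column c) →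
                       activeEntry ν c ≡ activeEntry ν' c → Agreement ρ ρ' ν ν' c
      through-last   : T.entry ρ last ≡ T.entry ρ' last →
                       activeEntry ν c ≡ nothing → activeEntry ν' c ≡ nothing → Agreement ρ ρ' ν ν' c

    agreement : ∀ ρ p ν ρ' p' ν' c → entry (small ρ p ν) c ≡ entry (small ρ' p' ν') c → Agreement ρ ρ' ν ν' c
    agreement ρ p ν ρ' p' ν' c e with activeEntry ν c in eν | activeEntry ν' c in eν'
    ... | just γ | just γ' = through-column (,-injectiveˡ (inj₁-injective e))
                                           (trans eν (trans (cong just (,-injectiveʳ (inj₁-injective e))) (sym eν')))
    ... | nothing | nothing = through-last (FinP.toℕ-injective sameLast) eν eν'
      where sameLast : lastEntry ρ ≡ lastEntry ρ'
            sameLast = trans (sym (FinP.toℕ-fromℕ< p)) (trans (cong toℕ (inj₂-injective e)) (FinP.toℕ-fromℕ< p'))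

    agreement-M₁ : ∀ {ρ ρ' ν ν' c} → Agreement ρ ρ' ν ν' c → activeEntry ν c ≡ activeEntry ν' c
    agreement-M₁ (through-column _ e) = e
    agreement-M₁ (through-last _ e e') = trans e (sym e')

    -- Small rows agreeing in two columns lie over the same row of T: the
    -- columns of T in which they agree are distinct, except when both are the
    -- last one, which would make ν idle.
    sameBlock : ∀ {ρ ρ' ν ν' i j} → i ≢ j → Agreement ρ ρ' ν ν' i → Agreement ρ ρ' ν ν' j → ρ ≡ ρ'
    sameBlock {ρ} {ρ'} i≢j (through-column tᵢ _) (through-column tⱼ _) = T.unique _ _ (column≢column i≢j) ρ ρ' tᵢ tⱼ
    sameBlock {ρ} {ρ'} {i = i} i≢j (through-column tᵢ _) (through-last tₗ _ _) = T.unique _ _ (column≢last i) ρ ρ' tᵢ tₗ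
    sameBlock {ρ} {ρ'} {j = j} i≢j (through-last tₗ _ _) (through-column tⱼ _) = T.unique _ _ (last≢column j) ρ ρ' tₗ tⱼ
    sameBlock {ν = ν} i≢j (through-last _ nᵢ _) (through-last _ nⱼ _) = ⊥-elim (active-not-idle ν i≢j nᵢ nⱼ)

    -- Rows agreeing in two columns are equal: big and inner rows inherit this
    -- from T, M and U; a big row and a small row would lie over the same row
    -- of T, which is either kept or not; an inner row and a small row would
    -- make the active row idle.
    unique : ∀ i j → i ≢ j → ∀ r r' → entry r i ≡ entry r' i → entry r j ≡ entry r' j → r ≡ r'
    unique i j i≢j (big ρ p σ) (big ρ' p' σ') eᵢ eⱼ
      with refl ← T.unique (column i) (column j) (column≢column i≢j) ρ ρ'
                    (,-injectiveˡ (inj₁-injective eᵢ)) (,-injectiveˡ (inj₁-injective eⱼ))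
      with refl ← M.unique i j i≢j σ σ' (,-injectiveʳ (inj₁-injective eᵢ)) (,-injectiveʳ (inj₁-injective eⱼ))
      = cong (λ p → big ρ p σ) (ℕP.≤-irrelevant p p')
    unique i j i≢j (big ρ p σ) (small ρ' p' ν') eᵢ eⱼ
      with refl ← T.unique (column i) (column j) (column≢column i≢j) ρ ρ'
                    (sym (small-inj₁ ρ' p' ν' i (sym eᵢ))) (sym (small-inj₁ ρ' p' ν' j (sym eⱼ)))
      = ⊥-elim (ℕP.<⇒≱ p' p)
    unique i j i≢j (small ρ p ν) (big ρ' p' σ') eᵢ eⱼ = sym (unique i j i≢j (big ρ' p' σ') (small ρ p ν) (sym eᵢ) (sym eⱼ))
    unique i j i≢j (small ρ p ν) (small ρ' p' ν') eᵢ eⱼ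
      with refl ← sameBlock i≢j (agreement ρ p ν ρ' p' ν' i eᵢ) (agreement ρ p ν ρ' p' ν' j eⱼ)
      with refl ← pair-injective (M₁.unique i j i≢j (pair ν) (pair ν')
                    (agreement-M₁ (agreement ρ p ν ρ' p' ν' i eᵢ)) (agreement-M₁ (agreement ρ p ν ρ' p' ν' j eⱼ)))
      = cong (λ p → small ρ p ν) (ℕP.<-irrelevant p p')
    unique i j i≢j (big _ _ _) (inner _) () _
    unique i j i≢j (inner _) (big _ _ _) () _
    unique i j i≢j (small ρ p ν) (inner τ') eᵢ eⱼ =
      ⊥-elim (active-not-idle ν i≢j (small-inj₂ ρ p ν i eᵢ) (small-inj₂ ρ p ν j eⱼ))
    unique i j i≢j (inner τ) (small ρ' p' ν') eᵢ eⱼ =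
      ⊥-elim (active-not-idle ν' i≢j (small-inj₂ ρ' p' ν' i (sym eᵢ)) (small-inj₂ ρ' p' ν' j (sym eⱼ)))
    unique i j i≢j (inner τ) (inner τ') eᵢ eⱼ =
      cong inner (U.unique i j i≢j τ τ' (inj₂-injective eᵢ) (inj₂-injective eⱼ))

    array : OrthogonalArray k Symbol Row
    array = record { entry = entry ; row = row ; row-i = row-i ; row-j = row-j ; unique = unique }

    symbols : Symbol ↔ Fin (t * m + u)
    symbols = ↔-sym (↔-trans FinP.+↔⊎ (FinP.*↔× ⊎-↔ ↔-refl))

    wilsonOA : OA k (Fin (t * m + u))
    wilsonOA = relabel symbols (toOA array)


module Arithmetic where

  open Congruence
  open import Data.Nat as ℕ using (ℕ; suc; NonZero; _≤_; _<_; _+_; _*_; _∸_; z≤n; s≤s)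
  import Data.Nat.Properties as ℕP
  open import Data.Nat.DivMod using (_/_; _%_; m≡m%n+[m/n]*n; m%n<n; m*n/n≡m; /-monoˡ-≤)
  import Data.Nat.Tactic.RingSolver as ℕSolver
  open import Data.Integer as ℤ using (ℤ; +_; _-_; -_)
  import Data.Integer.Properties as ℤP
  open import Data.Integer.Tactic.RingSolver using (solve-∀)
  import Data.Fin.Properties as FinP
  open import Data.Product using (Σ; _×_; _,_)
  open import Relation.Binary.PropositionalEquality

  unit-below-multiple : ∀ n L q → suc n ≡ L * q → + L ℤ.* + q ≈[ n ] + 1
  unit-below-multiple n L q e = mk (+ 1) (begin
      + L ℤ.* + q - + 1    ≡⟨ cong (_- + 1) (trans (sym (ℤP.pos-* L q)) (cong +_ (sym e))) ⟩
      + suc n - + 1        ≡⟨ cancel (+ n) ⟩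
      + 1 ℤ.* + n          ∎)
    where open ≡-Reasoning
          cancel : ∀ x → + 1 ℤ.+ x - + 1 ≡ + 1 ℤ.* x
          cancel = solve-∀

  unit-above-multiple : ∀ n L q → n ≡ suc (L * q) → + L ℤ.* - + q ≈[ n ] + 1
  unit-above-multiple n L q e = mk (- + 1) (begin
      + L ℤ.* - + q - + 1            ≡⟨ negate (+ L) (+ q) ⟩
      - + 1 ℤ.* (+ 1 ℤ.+ + L ℤ.* + q)  ≡⟨ cong (λ x → - + 1 ℤ.* x) (trans (cong (λ x → + 1 ℤ.+ x) (sym (ℤP.pos-* L q))) (cong +_ (sym e))) ⟩
      - + 1 ℤ.* + n                  ∎)
    where open ≡-Reasoning
          negate : ∀ a b → a ℤ.* - b - + 1 ≡ - + 1 ℤ.* (+ 1 ℤ.+ a ℤ.* b)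
          negate = solve-∀

  below-multiple : ∀ x L q → suc x ≡ L * q → + x ≈[ L ] - + 1
  below-multiple x L q e = mk (+ q) (begin
      + x - - + 1       ≡⟨ shift (+ x) ⟩
      + suc x           ≡⟨ cong +_ (trans e (ℕP.*-comm L q)) ⟩
      + (q * L)         ≡⟨ ℤP.pos-* q L ⟩
      + q ℤ.* + L       ∎)
    where open ≡-Reasoning
          shift : ∀ x → x - - + 1 ≡ + 1 ℤ.+ x
          shift = solve-∀

  residue-decomposition : ∀ L .{{_ : NonZero L}} n r → r < L → + n ≈[ L ] + r → n ≡ r + n / L * L
  residue-decomposition L n r r<L n≈r = trans (m≡m%n+[m/n]*n n L) (cong (_+ n / L * L) remainder≡r)
    where
      open Reduction L
      remainder≈n : + (n % L) ≈[ L ] + n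
      remainder≈n = subst (λ x → + x ≈[ L ] + n) (FinP.toℕ-fromℕ< (m%n<n n L)) (red-≈ (+ n))
      remainder≡r : n % L ≡ r
      remainder≡r = canonical (n % L) r (m%n<n n L) r<L (≈-trans remainder≈n n≈r)

  -- Take
  -- n - B + m = s·(L·m) + ρ with 0 ≤ ρ < L·m, t = L·s - 1 and u = B + ρ.
  wilsonSplit : ∀ L m B n .{{_ : NonZero (L * m)}} → B + (L * m) * (B + L * m) ≤ n →
                Σ ℕ λ t → Σ ℕ λ u → Σ ℕ λ s → suc t ≡ L * s × t * m + u ≡ n × B ≤ u × u ≤ t
  wilsonSplit L m B n bound = t , u , s , suc-t , sum , ℕP.m≤m+n B ρ , u≤t
    where
      D : ℕ
      D = L * m
      y : ℕ
      y = n ∸ B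
      B+y≡n : B + y ≡ n
      B+y≡n = ℕP.m+[n∸m]≡n (ℕP.m+n≤o⇒m≤o B bound)
      s : ℕ
      s = (y + m) / D
      ρ : ℕ
      ρ = (y + m) % D
      division : y + m ≡ ρ + s * D
      division = m≡m%n+[m/n]*n (y + m) D
      B+D≤s : B + D ≤ s
      B+D≤s = ℕP.≤-trans (ℕP.≤-reflexive (sym (m*n/n≡m (B + D) D)))
                (/-monoˡ-≤ D (ℕP.≤-trans (ℕP.≤-reflexive (ℕP.*-comm (B + D) D))
                  (ℕP.≤-trans (ℕP.m+n≤o⇒m≤o∸n (D * (B + D)) (ℕP.≤-trans (ℕP.≤-reflexive (ℕP.+-comm (D * (B + D)) B)) bound)) (ℕP.m≤m+n y m))))
      u : ℕ
      u = B + ρ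
      u<s : u < s
      u<s = ℕP.<-≤-trans (ℕP.+-monoʳ-< B (m%n<n (y + m) D)) B+D≤s
      1≤Ls : 1 ≤ L * s
      1≤Ls = ℕP.≤-trans (ℕP.≤-trans (s≤s z≤n) u<s) (ℕP.m≤n*m s L {{ℕP.m*n≢0⇒m≢0 L}})
      t : ℕ
      t = ℕ.pred (L * s)
      suc-t : suc t ≡ L * s
      suc-t = ℕP.suc-pred (L * s) {{ℕ.>-nonZero 1≤Ls}}
      u≤t : u ≤ t
      u≤t = ℕP.≤-pred (ℕP.≤-trans u<s (ℕP.≤-trans (ℕP.m≤n*m s L {{ℕP.m*n≢0⇒m≢0 L}}) (ℕP.≤-reflexive (sym suc-t))))
      sum : t * m + u ≡ n
      sum = ℕP.+-cancelʳ-≡ m (t * m + u) n (begin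
        t * m + (B + ρ) + m        ≡⟨ regroup₁ t m B ρ ⟩
        suc t * m + ρ + B          ≡⟨ cong (λ x → x * m + ρ + B) suc-t ⟩
        L * s * m + ρ + B          ≡⟨ regroup₂ L s m ρ B ⟩
        (ρ + s * D) + B            ≡⟨ cong (_+ B) (sym division) ⟩
        y + m + B                  ≡⟨ regroup₃ y m B ⟩
        (B + y) + m                ≡⟨ cong (_+ m) B+y≡n ⟩
        n + m                      ∎)
        where
          open ≡-Reasoning
          regroup₁ : ∀ t m B ρ → t * m + (B + ρ) + m ≡ suc t * m + ρ + B
          regroup₁ = ℕSolver.solve-∀
          regroup₂ : ∀ L s m ρ B → L * s * m + ρ + B ≡ (ρ + s * (L * m)) + B
          regroup₂ = ℕSolver.solve-∀
          regroup₃ : ∀ y m B → y + m + B ≡ (B + y) + m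
          regroup₃ = ℕSolver.solve-∀


-- With L = k!, the linear construction covers every
-- n ≡ ±1 (mod L); Wilson's construction, fed with a linear M on m ≡ -1
-- symbols and the shift array M₁ on m + 1 = L^L symbols, passes from the
-- residue r to r + 1 modulo L, at the price of a larger lower bound.
module Existence (k' : ℕ) where

  open Congruence
  open OrthogonalArrays
  open Linear using (module LinearArray; module UnitDifferences)
  open ShiftArrays using (module ShiftArray)
  open Wilson using (pointAtInfinity; module Construction)
  open Arithmetic
  open import Data.Nat as ℕ using (ℕ; zero; suc; NonZero; _≤_; _<_; _+_; _*_; _^_; _!; z≤n; s≤s; _≤′_; ≤′-refl; ≤′-step)
  import Data.Nat.Properties as ℕP
  open import Data.Nat.Divisibility using (_∣_; divides; ∣-trans; m≤n⇒m!∣n!)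
  open import Data.Integer as ℤ using (ℤ; +_; _-_; -_)
  import Data.Integer.Properties as ℤP
  open import Data.Integer.Tactic.RingSolver using (solve-∀)
  open import Data.Fin using (Fin; toℕ)
  import Data.Fin.Properties as FinP
  open import Data.Product using (Σ; _,_; proj₁; proj₂)
  open import Data.Maybe using (Maybe; nothing)
  open import Relation.Binary.PropositionalEquality

  k : ℕ
  k = suc (suc k')

  -- The modulus of the residue classes: every column difference divides L.
  L : ℕ
  L = k !

  instance
    L≢0 : NonZero L
    L≢0 = k ℕP.!≢0

  -- L ≥ 2, so that the residue 1 modulo L is a genuine residue.
  1<L : 1 < L
  1<L = ℕP.*-mono-≤ (s≤s (s≤s (z≤n {k'}))) (ℕP.1≤n! (suc k'))

  -- Every 1 ≤ d ≤ k divides L = k!, since d ∣ d! ∣ k!.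
  divides-L : ∀ d → 1 ≤ d → d ≤ k → d ∣ L
  divides-L (suc d) _ d≤k = ∣-trans (divides (d !) (ℕP.*-comm (suc d) (d !))) (m≤n⇒m!∣n! d≤k)

  linear : ∀ {c} → c ≤ suc k → ∀ n .{{_ : NonZero n}} (Q : ℤ) → + L ℤ.* Q ≈[ n ] + 1 → OA c (Fin n)
  linear c≤ n Q unit = LinearArray.linearOA _ n (UnitDifferences.differences k L n divides-L Q unit c≤)

  -- The ingredients M and M₁ of Wilson's construction, on m = L^L - 1 and
  -- m + 1 = L^L symbols.
  W : ℕ
  W = L ^ ℕ.pred L

  1≤W : 1 ≤ W
  1≤W = ℕP.m^n>0 L (ℕ.pred L)

  m : ℕ
  m = ℕ.pred (L * W)

  -- m + 1 = L·W = L^L, so m ≡ -1 (mod L).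
  suc-m : suc m ≡ L * W
  suc-m = ℕP.suc-pred (L * W) {{ℕ.>-nonZero (ℕP.*-mono-≤ (ℕP.<⇒≤ 1<L) 1≤W)}}

  L^L≡suc-m : L ^ L ≡ suc m
  L^L≡suc-m = trans (cong (L ^_) (sym (ℕP.suc-pred L))) (sym suc-m)

  instance
    m≢0 : NonZero m
    m≢0 = ℕ.>-nonZero (ℕP.≤-pred (ℕP.≤-trans (ℕP.≤-trans 1<L (ℕP.m≤m*n L W {{ℕ.>-nonZero 1≤W}})) (ℕP.≤-reflexive (sym suc-m))))
    D≢0 : NonZero (L * m)
    D≢0 = ℕP.m*n≢0 L m

  -- M: linear, since L·W ≡ 1 (mod m).
  M : OA k (Fin m)
  M = linear (ℕP.n≤1+n k) m (+ W) (unit-below-multiple m L W suc-m)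

  -- M₁: the shift array for L, since L·(-1) ≡ 1 (mod L + 1), with its
  -- idempotent row turned into the idle row.
  module Shifts = ShiftArray k L
    (UnitDifferences.differences k L (suc L) divides-L (- + 1)
       (unit-above-multiple (suc L) L 1 (cong suc (sym (ℕP.*-identityʳ L)))) (ℕP.n≤1+n k))

  M₁-with-idle : Σ (OA k (Maybe (Fin m))) λ M₁ → ∀ i → OrthogonalArray.entry M₁ (nothing , nothing) i ≡ nothing
  M₁-with-idle = pointAtInfinity L^L≡suc-m Shifts.shiftOA (Shifts.code Shifts.zeroV) Shifts.idempotent

  D : ℕ
  D = L * m

  -- Wilson's step: if all n ≥ B with n ≡ r (mod L) are covered, so are all
  -- n ≥ B + D·(B + D) with n ≡ r + 1, writing n = t·m + u as in wilsonSplit,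
  -- with a linear T on t ≡ -1 symbols and U on u ≡ r symbols.
  step : ∀ B r → 1 ≤ B → (∀ n → B ≤ n → + n ≈[ L ] + r → OA k (Fin n)) →
         ∀ n → B + D * (B + D) ≤ n → + n ≈[ L ] + suc r → OA k (Fin n)
  step B r 1≤B available n large n≈ with wilsonSplit L m B n large
  ... | t , u , s , suc-t , sum , B≤u , u≤t =
    subst (λ x → OA k (Fin x)) sum
      (Construction.wilsonOA k' t m u u≤t T M (proj₁ M₁-with-idle) (proj₂ M₁-with-idle) U)
    where
      instance
        t≢0 : NonZero t
        t≢0 = ℕ.>-nonZero (ℕP.≤-trans (ℕP.≤-trans 1≤B B≤u) u≤t)
      T : OA (suc k) (Fin t)
      T = linear ℕP.≤-refl t (+ s) (unit-below-multiple t L s suc-t)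
      open ≈-Reasoning L
      cancel : ∀ a b → b ≡ a ℤ.+ b - a
      cancel = solve-∀
      dropOne : ∀ x → + 1 ℤ.+ x - - + 1 ℤ.* - + 1 ≡ x
      dropOne = solve-∀
      -- u = n - t·m ≡ (r + 1) - (-1)·(-1) = r  (mod L)
      u≈r : + u ≈[ L ] + r
      u≈r = begin
        + u                           ≡⟨ cancel (+ t ℤ.* + m) (+ u) ⟩
        + t ℤ.* + m ℤ.+ + u - + t ℤ.* + m   ≡⟨ cong (λ x → x - + t ℤ.* + m) (trans (cong (ℤ._+ + u) (sym (ℤP.pos-* t m))) (trans (sym (ℤP.pos-+ (t * m) u)) (cong +_ sum))) ⟩
        + n - + t ℤ.* + m             ≈⟨ ≈-- n≈ (≈-* (below-multiple t L s suc-t) (below-multiple m L W suc-m)) ⟩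
        + suc r - - + 1 ℤ.* - + 1     ≡⟨ cong (λ y → y - - + 1 ℤ.* - + 1) (ℤP.pos-+ 1 r) ⟩
        + 1 ℤ.+ + r - - + 1 ℤ.* - + 1 ≡⟨ dropOne (+ r) ⟩
        + r                           ∎
      U : OA k (Fin u)
      U = available u B≤u u≈r

  bound : ℕ → ℕ
  bound zero = 1
  bound (suc r) = bound r + D * (bound r + D)

  1≤bound : ∀ r → 1 ≤ bound r
  1≤bound zero = ℕP.≤-refl
  1≤bound (suc r) = ℕP.≤-trans (1≤bound r) (ℕP.m≤m+n (bound r) _)

  bound-mono : ∀ {j j'} → j ≤′ j' → bound j ≤ bound j'
  bound-mono ≤′-refl = ℕP.≤-refl
  bound-mono (≤′-step j≤j') = ℕP.≤-trans (bound-mono j≤j') (ℕP.m≤m+n _ _)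

  -- Arrays on all n ≥ bound r with n ≡ r + 1 (mod L), by induction on r;
  -- for r = 0, n = L·q + 1 and the linear array applies.
  residue : ∀ r n → bound r ≤ n → + n ≈[ L ] + suc r → OA k (Fin n)
  residue zero n 1≤n n≈1 =
    linear (ℕP.n≤1+n k) n {{ℕ.>-nonZero 1≤n}} (- + q) (unit-above-multiple n L q n≡)
    where
      q : ℕ
      q = n ℕ./ L
      n≡ : n ≡ suc (L * q)
      n≡ = trans (residue-decomposition L n 1 1<L n≈1) (cong suc (ℕP.*-comm q L))
  residue (suc r) = step (bound r) (suc r) (1≤bound r) (residue r)

  -- Every n ≥ bound L lies in one of the residue classes r + 1, r < L.
  orthogonalArray : ∀ n → bound L ≤ n → OA k (Fin n)
  orthogonalArray n large = residue r n (ℕP.≤-trans (bound-mono (ℕP.≤⇒≤′ (ℕP.<⇒≤ r<L))) large) n≈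
    where
      open Reduction L using (red; red-≈)
      x : ℕ
      x = n + ℕ.pred L
      r : ℕ
      r = toℕ (red (+ x))
      r<L : r < L
      r<L = FinP.toℕ<n (red (+ x))
      n+L≡ : n + L ≡ suc x
      n+L≡ = trans (cong (λ y → n + y) (sym (ℕP.suc-pred L))) (ℕP.+-suc n (ℕ.pred L))
      open ≈-Reasoning L
      n≈ : + n ≈[ L ] + suc r
      n≈ = begin
        + n                        ≡⟨ ℤP.+-identityʳ (+ n) ⟨
        + n ℤ.+ + 0                ≈⟨ ≈-+ (≈-refl {a = + n}) (≈-multiple (+ 1)) ⟨
        + n ℤ.+ + 1 ℤ.* + L        ≡⟨ cong (λ y → + n ℤ.+ y) (ℤP.*-identityˡ (+ L)) ⟩
        + n ℤ.+ + L                ≡⟨ ℤP.pos-+ n L ⟨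
        + (n + L)                  ≡⟨ cong +_ n+L≡ ⟩
        + (1 + x)                  ≡⟨ ℤP.pos-+ 1 x ⟩
        + 1 ℤ.+ + x                ≈⟨ ≈-+ (≈-refl {a = + 1}) (red-≈ (+ x)) ⟨
        + 1 ℤ.+ + r                ≡⟨ ℤP.pos-+ 1 r ⟨
        + suc r                    ∎


lemma3 : (k : ℕ) → 2 ≤ k → (a : Fin k → ℕ) → ((i : Fin k) → 1 ≤ a i) →
         ∃[ p₀ ] ((p : ℕ) → p₀ ≤ p → EmbeddedDecomposition k a p)
lemma3 (suc (suc k')) (s≤s (s≤s z≤n)) a a-pos =
  bound L , λ p p-large →
    Decomposition.FromOrthogonalArray.decomposition k a a-pos p _
      (OrthogonalArrays.enumerateRows (orthogonalArray p p-large))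
  where open Existence k'
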